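{- Let $G$ be a connected finite simple graph and let $H,K$ be subgraphs of $G$ with $H\cup K=G$ and $H\cap K=K_r=(U,F)$ a complete graph (a separating clique), where neither $H$ nor $K$ coincides with $K_r$. Then, writing $Q(\cdot)$ for $Q(\cdot;x,y)$, \[ Q(G)=Q(H-U)\,Q(K-U)+\frac{1}{y}\sum_{\emptyset\neq A\subseteq U}\frac{1}{x^{|A|}}\sum_{\substack{B\subseteq U\\ B\supseteq U\setminus A}}\ \sum_{\substack{C\subseteq U\\ C\supseteq U\setminus A}}(-1)^{|B|+|C|}\,Q(H-B)\,Q(K-C). \]
   Context: For a finite simple graph $G=(V,E)$, $Q(G;x,y)=\sum_{X\subseteq V}x^{|X|}y^{k(G[X])}$, where $G[X]$ is the induced subgraph and $k$ the number of connected components (the null graph has $k=0$). For a vertex set $B$, $H-B$ denotes the graph obtained from $H$ by removing the vertices of $B$ and their incident edges. -}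

module Defs where

open import Data.Nat using (ℕ; zero; suc)
open import Data.Bool using (Bool; true; false; _∧_; _∨_; not; if_then_else_)
open import Data.Fin using (Fin; _<?_) renaming (zero to fzero; suc to fsuc)
open import Data.Fin.Subset using (Subset; _∈_; _⊆_; _∪_; _∩_; _─_; ⁅_⁆; ∣_∣; Nonempty)
open import Data.Vec using (Vec; []; _∷_; lookup; tabulate)
open import Data.List using (List; []; _∷_; concatMap; filter; map; foldr; length)
open import Data.Bool.ListAction using (any)
open import Data.List.Base using (allFin)
open import Data.Rational using (ℚ; 0ℚ; 1ℚ; _+_; _*_; -_)
open import Data.Product using (_×_)
open import Relation.Binary.PropositionalEquality using (_≡_; _≢_)
open import Relation.Nullary.Decidable using (⌊_⌋)
open import Function using (_∘_)

record Graph (n : ℕ) : Set where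
  constructor mkGraph
  field
    V : Subset n
    E : Fin n → Fin n → Bool
open Graph public

SimpleGraph : ∀ {n} → Graph n → Set
SimpleGraph G =
  (∀ u v → E G u v ≡ E G v u) ×
  (∀ u → E G u u ≡ false) ×
  (∀ u v → E G u v ≡ true → (u ∈ V G) × (v ∈ V G))

_IsSubgraphOf_ : ∀ {n} → Graph n → Graph n → Set
H IsSubgraphOf G = SimpleGraph H × (V H ⊆ V G) × (∀ u v → E H u v ≡ true → E G u v ≡ true)

_∪ᴳ_≡_ : ∀ {n} → Graph n → Graph n → Graph n → Set
H ∪ᴳ K ≡ G = (V H ∪ V K ≡ V G) × (∀ u v → E G u v ≡ (E H u v ∨ E K u v))

_∩ᴳ_≡_ : ∀ {n} → Graph n → Graph n → Graph n → Set
H ∩ᴳ K ≡ L = (V H ∩ V K ≡ V L) × (∀ u v → E L u v ≡ (E H u v ∧ E K u v))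

_≅ᴳ_ : ∀ {n} → Graph n → Graph n → Set
H ≅ᴳ K = (V H ≡ V K) × (∀ u v → E H u v ≡ E K u v)

Complete : ∀ {n} → Graph n → Set
Complete L = ∀ u v → u ∈ V L → v ∈ V L → u ≢ v → E L u v ≡ true

data Reach {n} (G : Graph n) : Fin n → Fin n → Set where
  here : ∀ {u} → u ∈ V G → Reach G u u
  step : ∀ {u w v} → u ∈ V G → E G u w ≡ true → Reach G w v → Reach G u v

Connected : ∀ {n} → Graph n → Set
Connected G = ∀ u v → u ∈ V G → v ∈ V G → Reach G u v

_∈ᵇ_ : ∀ {n} → Fin n → Subset n → Bool
u ∈ᵇ B = lookup B u

_-ᴳ_ : ∀ {n} → Graph n → Subset n → Graph n
H -ᴳ B = mkGraph (V H ─ B) (λ u v → E H u v ∧ not (u ∈ᵇ B) ∧ not (v ∈ᵇ B))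

induced : ∀ {n} → Graph n → Subset n → Graph n
induced G X = mkGraph (V G ∩ X) (λ u v → E G u v ∧ (u ∈ᵇ X) ∧ (v ∈ᵇ X))

-- Number of connected components k(G), computed as follows:
-- comp G v is the set of vertices reachable from v (n rounds of
-- breadth-first expansion suffice in a graph with at most n vertices),
-- and k(G) counts the vertices v ∈ V that are the least vertex of
-- their component (one canonical representative per component).

anyFin : ∀ {n} → (Fin n → Bool) → Bool
anyFin {n} p = any p (allFin n)

expand : ∀ {n} → Graph n → Subset n → Subset n
expand G R = tabulate (λ w → (w ∈ᵇ R) ∨ ((w ∈ᵇ V G) ∧ anyFin (λ v → (v ∈ᵇ R) ∧ E G v w)))

iter : ∀ {n} → ℕ → Graph n → Subset n → Subset n
iter zero    G R = R
iter (suc m) G R = expand G (iter m G R)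

comp : ∀ {n} → Graph n → Fin n → Subset n
comp {n} G v = iter n G ⁅ v ⁆

isRep : ∀ {n} → Graph n → Fin n → Bool
isRep G v = (v ∈ᵇ V G) ∧ not (anyFin (λ w → ⌊ w <? v ⌋ ∧ (w ∈ᵇ comp G v)))

countFin : ∀ {n} → (Fin n → Bool) → ℕ
countFin {n} p = length (filter (λ i → p i ≟b true) (allFin n))
  where
  open import Data.Bool using () renaming (_≟_ to _≟b_)

components : ∀ {n} → Graph n → ℕ
components G = countFin (isRep G)

Σ[_] : ∀ {A : Set} → List A → (A → ℚ) → ℚ
Σ[ xs ] f = foldr (λ a s → f a + s) 0ℚ xs

_^_ : ℚ → ℕ → ℚ
p ^ zero  = 1ℚ
p ^ suc m = p * (p ^ m)

allSubsets : (n : ℕ) → List (Subset n)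
allSubsets zero    = [] ∷ []
allSubsets (suc n) = concatMap (λ s → (false ∷ s) ∷ (true ∷ s) ∷ []) (allSubsets n)

subsetsWith : (n : ℕ) → (Subset n → Bool) → List (Subset n)
subsetsWith n p = filter (λ X → p X ≟b true) (allSubsets n)
  where
  open import Data.Bool using () renaming (_≟_ to _≟b_)

_⊆ᵇ_ : ∀ {n} → Subset n → Subset n → Bool
X ⊆ᵇ Y = not (anyFin (λ i → (i ∈ᵇ X) ∧ not (i ∈ᵇ Y)))

nonemptyᵇ : ∀ {n} → Subset n → Bool
nonemptyᵇ X = anyFin (λ i → i ∈ᵇ X)

Q : ∀ {n} → Graph n → ℚ → ℚ → ℚ
Q {n} G x y = Σ[ subsetsWith n (λ X → X ⊆ᵇ V G) ] (λ X → (x ^ ∣ X ∣) * (y ^ components (induced G X)))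

sgn : ℕ → ℚ
sgn m = (- 1ℚ) ^ m

module Submission where

-- Write X ⊆ V G as the pair (X ∩ V H, X ∩ V K): the subsets of V G
-- are exactly the pairs (Y, Z) of subsets of V H and V K with the same trace
-- Y ∩ U = Z ∩ U.  Gluing H[Y] and K[Z] along the clique on their common
-- trace A merges the components through A into one, so the weight x^|X|
-- y^k(G[X]) is x^-|A| y^-1 times the product of the weights of Y and Z when
-- A ≠ ∅, and just that product when A = ∅.  On the other side, by
-- inclusion–exclusion the alternating sum of Q(H - B) over U ─ A ⊆ B ⊆ U
-- picks out exactly the subsets Y of V H with trace A; the double sum over
-- B and C in the statement is a product of two such sums.  Sorting both
-- sides by the trace A gives the same expression.

open import Defs
open import Data.Nat as ℕ using (ℕ; zero; suc; s≤s) renaming (_+_ to _+ℕ_)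
import Data.Nat.Properties as ℕ
open import Data.Bool using (Bool; true; false; _∧_; _∨_; not; if_then_else_)
open import Data.Bool.Properties
  using (∧-zeroʳ; ∧-identityʳ; ∧-assoc; ∧-comm; ∧-distribʳ-∨; ∨-comm) renaming (_≟_ to _≟ᵇ_)
open import Data.Bool.ListAction using (any)
open import Data.Fin as Fin using (Fin; _<?_) renaming (zero to fzero; suc to fsuc)
import Data.Fin.Properties as Fin
import Data.Fin.Induction as Fin
open import Data.Fin.Subset using (Subset; _∈_; _∩_; _∪_; _─_; ⊥; ∣_∣; ⁅_⁆)
open import Data.Fin.Subset.Properties
  using (x∈⁅x⁆; x∈⁅y⁆⇒x≡y; ∣⁅x⁆∣≡1; ∣p∣≤n; ∣⊥∣≡0; x∈p∩q⁺; x∈p∩q⁻;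
         ∩-distribˡ-∪; ∩-distribʳ-∪; ∩-idempotentCommutativeMonoid)
open import Data.Vec using ([]; _∷_)
open import Data.Vec.Properties
  using (lookup∘tabulate; tabulate∘lookup; tabulate-cong; []=⇒lookup; lookup⇒[]=;
         lookup-zipWith; lookup-replicate)
open import Data.List as List using (List; []; _∷_; _++_; concatMap; filter)
open import Data.Rational using (ℚ; 0ℚ; 1ℚ; _+_; _*_; -_; 1/_; NonZero)
open import Data.Rational.Properties
  using (+-identityˡ; +-identityʳ; +-assoc; *-identityˡ; *-identityʳ; *-zeroˡ; *-zeroʳ;
         *-comm; *-assoc; *-distribˡ-+; *-distribʳ-+; *-inverseˡ;
         +-0-commutativeMonoid; *-1-commutativeMonoid)
open import Data.Rational.Solver using (module +-*-Solver)
open import Data.Product using (∃; _×_; _,_; proj₁; proj₂; swap)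
open import Data.Sum using (_⊎_; inj₁; inj₂; [_,_]′)
open import Data.Empty using (⊥-elim)
open import Relation.Nullary using (¬_; yes; no)
open import Relation.Nullary.Decidable using (⌊_⌋)
open import Relation.Binary using (tri<; tri≈; tri>)
open import Relation.Binary.PropositionalEquality
open import Induction.WellFounded using (Acc; acc)
open import Function using (_∘_; id)
open import Algebra.Bundles using (CommutativeMonoid)
import Algebra.Properties.CommutativeSemigroup as CommutativeSemigroupProperties
import Algebra.Solver.IdempotentCommutativeMonoid as ICM

open CommutativeSemigroupProperties (CommutativeMonoid.commutativeSemigroup +-0-commutativeMonoid)
  using () renaming (interchange to +-interchange)
open CommutativeSemigroupProperties (CommutativeMonoid.commutativeSemigroup *-1-commutativeMonoid)
  using () renaming (interchange to *-interchange)
open CommutativeSemigroupProperties ℕ.+-commutativeSemigroup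
  using () renaming (interchange to ℕ-+-interchange)

private variable
  n : ℕ
  u : Fin n

∨-true : ∀ {a b} → a ∨ b ≡ true → a ≡ true ⊎ b ≡ true
∨-true {true}  _ = inj₁ refl
∨-true {false} e = inj₂ e

∧-true : ∀ {a b} → a ∧ b ≡ true → a ≡ true × b ≡ true
∧-true {true} {true} _ = refl , refl

∧-intro : ∀ {a b} → a ≡ true → b ≡ true → a ∧ b ≡ true
∧-intro refl refl = refl

∨-introˡ : ∀ {a} b → a ≡ true → a ∨ b ≡ true
∨-introˡ b refl = refl

∨-introʳ : ∀ a {b} → b ≡ true → a ∨ b ≡ true
∨-introʳ true  _ = refl
∨-introʳ false e = e

not-true : ∀ {a} → not a ≡ true → a ≡ false
not-true {false} _ = refl

true≢false : ∀ {a} → a ≡ true → a ≡ false → ∀ {A : Set} → A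
true≢false refl ()

bool-ext : ∀ {a b} → (a ≡ true → b ≡ true) → (b ≡ true → a ≡ true) → a ≡ b
bool-ext {true}  {true}  f g = refl
bool-ext {true}  {false} f g = sym (f refl)
bool-ext {false} {true}  f g = g refl
bool-ext {false} {false} f g = refl

_==_ : Bool → Bool → Bool
true  == b = b
false == b = not b

∈⇒ᵇ : {S : Subset n} → u ∈ S → u ∈ᵇ S ≡ true
∈⇒ᵇ = []=⇒lookup

ᵇ⇒∈ : {S : Subset n} → u ∈ᵇ S ≡ true → u ∈ S
ᵇ⇒∈ {u = u} {S = S} = lookup⇒[]= u S

infix 4.5 _⊆?_ _≐_

-- Unlike the tests of Defs, which search over Fin n, they reduce on cons
-- cells; this is what makes the coordinatewise inductions below run.
_⊆?_ : Subset n → Subset n → Bool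
[]      ⊆? []      = true
(a ∷ X) ⊆? (b ∷ Y) = (not a ∨ b) ∧ (X ⊆? Y)

_≐_ : Subset n → Subset n → Bool
[]      ≐ []      = true
(a ∷ X) ≐ (b ∷ Y) = (a == b) ∧ (X ≐ Y)

≐-sound : (X Y : Subset n) → X ≐ Y ≡ true → X ≡ Y
≐-sound []          []          _ = refl
≐-sound (true  ∷ X) (true  ∷ Y) e = cong (true  ∷_) (≐-sound X Y e)
≐-sound (false ∷ X) (false ∷ Y) e = cong (false ∷_) (≐-sound X Y e)

≐-refl : (X : Subset n) → X ≐ X ≡ true
≐-refl []          = refl
≐-refl (true  ∷ X) = ≐-refl X
≐-refl (false ∷ X) = ≐-refl X

≐-sym : (X Y : Subset n) → X ≐ Y ≡ Y ≐ X
≐-sym []          []          = refl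
≐-sym (true  ∷ X) (true  ∷ Y) = ≐-sym X Y
≐-sym (true  ∷ X) (false ∷ Y) = refl
≐-sym (false ∷ X) (true  ∷ Y) = refl
≐-sym (false ∷ X) (false ∷ Y) = ≐-sym X Y

anyFin-suc : (p : Fin (suc n) → Bool) → anyFin p ≡ p fzero ∨ anyFin (p ∘ fsuc)
anyFin-suc p = cong (p fzero ∨_) (any-tabulate p fsuc)
  where
  any-tabulate : ∀ {m} {A : Set} (p : A → Bool) (f : Fin m → A) →
    any p (List.tabulate f) ≡ anyFin (p ∘ f)
  any-tabulate {zero}  p f = refl
  any-tabulate {suc m} p f = cong (p (f fzero) ∨_)
    (trans (any-tabulate p (f ∘ fsuc)) (sym (any-tabulate (p ∘ f) fsuc)))

anyFin-witness : (p : Fin n → Bool) → anyFin p ≡ true → ∃ λ i → p i ≡ true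
anyFin-witness {suc n} p e with ∨-true {p fzero} (trans (sym (anyFin-suc p)) e)
... | inj₁ p0 = fzero , p0
... | inj₂ ps with anyFin-witness (p ∘ fsuc) ps
...   | i , pi = fsuc i , pi

anyFin-intro : (p : Fin n → Bool) (i : Fin n) → p i ≡ true → anyFin p ≡ true
anyFin-intro p fzero    e = trans (anyFin-suc p) (∨-introˡ _ e)
anyFin-intro p (fsuc i) e = trans (anyFin-suc p) (∨-introʳ (p fzero) (anyFin-intro (p ∘ fsuc) i e))

anyFin-cong : {p q : Fin n → Bool} → (∀ i → p i ≡ q i) → anyFin p ≡ anyFin q
anyFin-cong {zero}          e = refl
anyFin-cong {suc n} {p} {q} e =
  trans (anyFin-suc p) (trans (cong₂ _∨_ (e fzero) (anyFin-cong (e ∘ fsuc))) (sym (anyFin-suc q)))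

⊆ᵇ≡⊆? : (X Y : Subset n) → X ⊆ᵇ Y ≡ X ⊆? Y
⊆ᵇ≡⊆? []      []      = refl
⊆ᵇ≡⊆? (a ∷ X) (b ∷ Y) with a | b | anyFin-suc (λ i → (i ∈ᵇ (a ∷ X)) ∧ not (i ∈ᵇ (b ∷ Y)))
... | true  | true  | e = trans (cong not e) (⊆ᵇ≡⊆? X Y)
... | true  | false | e = cong not e
... | false | _     | e = trans (cong not e) (⊆ᵇ≡⊆? X Y)

nonemptyᵇ≡ : (X : Subset n) → nonemptyᵇ X ≡ not (X ≐ ⊥)
nonemptyᵇ≡ []      = refl
nonemptyᵇ≡ (a ∷ X) with a | anyFin-suc (λ i → i ∈ᵇ (a ∷ X))
... | true  | e = e
... | false | e = trans e (nonemptyᵇ≡ X)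

≐⊥-witness : (X : Subset n) → X ≐ ⊥ ≡ false → ∃ λ a → a ∈ᵇ X ≡ true
≐⊥-witness X empty = anyFin-witness (λ i → i ∈ᵇ X) (trans (nonemptyᵇ≡ X) (cong not empty))

⊥-⊆? : (U : Subset n) → ⊥ ⊆? U ≡ true
⊥-⊆? []      = refl
⊥-⊆? (u ∷ U) = ⊥-⊆? U

∩-⊆? : (X U : Subset n) → X ∩ U ⊆? U ≡ true
∩-⊆? []          []          = refl
∩-⊆? (true  ∷ X) (true  ∷ U) = ∩-⊆? X U
∩-⊆? (true  ∷ X) (false ∷ U) = ∩-⊆? X U
∩-⊆? (false ∷ X) (u     ∷ U) = ∩-⊆? X U

⊆?-∩ : (A U : Subset n) → A ⊆? U ≡ true → A ∩ U ≡ A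
⊆?-∩ []          []          _ = refl
⊆?-∩ (true  ∷ A) (true  ∷ U) e = cong (true  ∷_) (⊆?-∩ A U e)
⊆?-∩ (false ∷ A) (u     ∷ U) e = cong (false ∷_) (⊆?-∩ A U e)

⊆?-─ : (Y V B : Subset n) → Y ⊆? (V ─ B) ≡ (Y ⊆? V) ∧ (Y ∩ B ≐ ⊥)
⊆?-─ []          []      []          = refl
⊆?-─ (false ∷ Y) (v ∷ V) (b     ∷ B) = ⊆?-─ Y V B
⊆?-─ (true  ∷ Y) (v ∷ V) (true  ∷ B) = sym (∧-zeroʳ (v ∧ (Y ⊆? V)))
⊆?-─ (true  ∷ Y) (v ∷ V) (false ∷ B) = trans (cong (v ∧_) (⊆?-─ Y V B)) (sym (∧-assoc v _ _))

─-cons : ∀ u a (U A : Subset n) → (u ∷ U) ─ (a ∷ A) ≡ (u ∧ not a) ∷ (U ─ A)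
─-cons u true  U A = cong (_∷ (U ─ A)) (sym (∧-zeroʳ u))
─-cons u false U A = cong (_∷ (U ─ A)) (sym (∧-identityʳ u))

lookup-─ : (A B : Subset n) (t : Fin n) → t ∈ᵇ (A ─ B) ≡ (t ∈ᵇ A) ∧ not (t ∈ᵇ B)
lookup-─ (a ∷ A) (true  ∷ B) fzero    = sym (∧-zeroʳ a)
lookup-─ (a ∷ A) (false ∷ B) fzero    = sym (∧-identityʳ a)
lookup-─ (a ∷ A) (b     ∷ B) (fsuc t) = lookup-─ A B t

subset-ext : {A B : Subset n} → (∀ i → i ∈ᵇ A ≡ i ∈ᵇ B) → A ≡ B
subset-ext {A = A} {B} same = trans (sym (tabulate∘lookup A)) (trans (tabulate-cong same) (tabulate∘lookup B))

∣∪∣+∣∩∣ : (X Y : Subset n) → ∣ X ∪ Y ∣ +ℕ ∣ X ∩ Y ∣ ≡ ∣ X ∣ +ℕ ∣ Y ∣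
∣∪∣+∣∩∣ []          []          = refl
∣∪∣+∣∩∣ (true  ∷ X) (true  ∷ Y) =
  cong suc (trans (ℕ.+-suc _ _) (trans (cong suc (∣∪∣+∣∩∣ X Y)) (sym (ℕ.+-suc _ _))))
∣∪∣+∣∩∣ (true  ∷ X) (false ∷ Y) = cong suc (∣∪∣+∣∩∣ X Y)
∣∪∣+∣∩∣ (false ∷ X) (true  ∷ Y) = trans (cong suc (∣∪∣+∣∩∣ X Y)) (sym (ℕ.+-suc _ _))
∣∪∣+∣∩∣ (false ∷ X) (false ∷ Y) = ∣∪∣+∣∩∣ X Y

when : Bool → ℚ → ℚ
when b q = if b then q else 0ℚ

when-zero : ∀ b → when b 0ℚ ≡ 0ℚ
when-zero true  = refl
when-zero false = refl

when-∧ : ∀ a b q → when (a ∧ b) q ≡ when a (when b q)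
when-∧ true  b q = refl
when-∧ false b q = refl

when-comm : ∀ a b q → when a (when b q) ≡ when b (when a q)
when-comm true  b q = refl
when-comm false b q = sym (when-zero b)

when-*ˡ : ∀ b c q → when b (c * q) ≡ c * when b q
when-*ˡ true  c q = refl
when-*ˡ false c q = sym (*-zeroʳ c)

when-factor : ∀ l t c v → when (l ∧ t) (c * v) ≡ when l c * when t v
when-factor false t c v = sym (*-zeroˡ (when t v))
when-factor true  t c v = when-*ˡ t c v

when-cong : ∀ b {q r} → (b ≡ true → q ≡ r) → when b q ≡ when b r
when-cong true  e = e refl
when-cong false e = refl

≐-guards : (S T A : Subset n) (q : ℚ) → when (S ≐ A) (when (T ≐ A) q) ≡ when (S ≐ T) (when (S ≐ A) q)
≐-guards S T A q with S ≐ A in S≐A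
... | false = sym (when-zero (S ≐ T))
... | true rewrite ≐-sound S A S≐A | ≐-sym T A = refl

when₂-zero : ∀ p q → when p (when q 0ℚ) ≡ 0ℚ
when₂-zero p q = trans (cong (when p) (when-zero q)) (when-zero p)

guarded-zero : ∀ p q s → when p (when q (s * 0ℚ)) ≡ 0ℚ
guarded-zero p q s = trans (cong (λ z → when p (when q z)) (*-zeroʳ s)) (when₂-zero p q)

when-* : ∀ a c p q → when a p * when c q ≡ when a (when c (p * q))
when-* false c p q = *-zeroˡ (when c q)
when-* true  c p q = sym (when-*ˡ c p q)

when-shuffle : ∀ p q a d s w →
  when p (when q (s * when a (when d w))) ≡ when a (w * when p (when q (when d s)))
when-shuffle p q false d     s w = guarded-zero p q s
when-shuffle p q true  false s w =
  trans (guarded-zero p q s) (sym (trans (cong (w *_) (when₂-zero p q)) (*-zeroʳ w)))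
when-shuffle p q true  true  s w =
  trans (cong (λ z → when p (when q z)) (*-comm s w)) (trans (cong (when p) (when-*ˡ q w s)) (when-*ˡ p w (when q s)))

when-pull : ∀ a c w s → when a (w * when c s) ≡ s * when a (when c w)
when-pull a c w s = begin
  when a (w * when c s)  ≡⟨ cong (when a) (sym (when-*ˡ c w s)) ⟩
  when a (when c (w * s)) ≡⟨ cong (λ z → when a (when c z)) (*-comm w s) ⟩
  when a (when c (s * w)) ≡⟨ cong (when a) (when-*ˡ c s w) ⟩
  when a (s * when c w)  ≡⟨ when-*ˡ a s (when c w) ⟩
  s * when a (when c w)  ∎
  where open ≡-Reasoning

Σ-cong : ∀ {A : Set} (xs : List A) {f g : A → ℚ} → (∀ a → f a ≡ g a) → Σ[ xs ] f ≡ Σ[ xs ] g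
Σ-cong []       e = refl
Σ-cong (x ∷ xs) e = cong₂ _+_ (e x) (Σ-cong xs e)

Σ-zero : ∀ {A : Set} (xs : List A) → Σ[ xs ] (λ _ → 0ℚ) ≡ 0ℚ
Σ-zero []       = refl
Σ-zero (x ∷ xs) = trans (+-identityˡ _) (Σ-zero xs)

Σ-+ : ∀ {A : Set} (xs : List A) (f g : A → ℚ) → Σ[ xs ] (λ a → f a + g a) ≡ Σ[ xs ] f + Σ[ xs ] g
Σ-+ []       f g = refl
Σ-+ (x ∷ xs) f g =
  trans (cong ((f x + g x) +_) (Σ-+ xs f g)) (+-interchange (f x) (g x) (Σ[ xs ] f) (Σ[ xs ] g))

Σ-*ˡ : ∀ {A : Set} (xs : List A) (c : ℚ) (f : A → ℚ) → Σ[ xs ] (λ a → c * f a) ≡ c * Σ[ xs ] f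
Σ-*ˡ []       c f = sym (*-zeroʳ c)
Σ-*ˡ (x ∷ xs) c f = trans (cong (c * f x +_) (Σ-*ˡ xs c f)) (sym (*-distribˡ-+ c (f x) _))

Σ-*ʳ : ∀ {A : Set} (xs : List A) (c : ℚ) (f : A → ℚ) → Σ[ xs ] (λ a → f a * c) ≡ Σ[ xs ] f * c
Σ-*ʳ xs c f = trans (Σ-cong xs (λ a → *-comm (f a) c)) (trans (Σ-*ˡ xs c f) (*-comm c _))

Σ-swap : ∀ {A B : Set} (xs : List A) (ys : List B) (f : A → B → ℚ) →
  Σ[ xs ] (λ a → Σ[ ys ] (f a)) ≡ Σ[ ys ] (λ b → Σ[ xs ] (λ a → f a b))
Σ-swap []       ys f = sym (Σ-zero ys)
Σ-swap (x ∷ xs) ys f =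
  trans (cong (Σ[ ys ] (f x) +_) (Σ-swap xs ys f)) (sym (Σ-+ ys (f x) (λ b → Σ[ xs ] (λ a → f a b))))

Σ-product : ∀ {A B : Set} (xs : List A) (ys : List B) (f : A → ℚ) (g : B → ℚ) →
  Σ[ xs ] f * Σ[ ys ] g ≡ Σ[ xs ] (λ a → Σ[ ys ] (λ b → f a * g b))
Σ-product xs ys f g = sym (trans (Σ-cong xs (λ a → Σ-*ˡ ys (f a) g)) (Σ-*ʳ xs (Σ[ ys ] g) f))

Σ-++ : ∀ {A : Set} (xs ys : List A) (f : A → ℚ) → Σ[ xs ++ ys ] f ≡ Σ[ xs ] f + Σ[ ys ] f
Σ-++ []       ys f = sym (+-identityˡ _)
Σ-++ (x ∷ xs) ys f = trans (cong (f x +_) (Σ-++ xs ys f)) (sym (+-assoc (f x) _ _))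

Σ-filter : ∀ {A : Set} (p : A → Bool) (xs : List A) (f : A → ℚ) →
  Σ[ filter (λ a → p a ≟ᵇ true) xs ] f ≡ Σ[ xs ] (λ a → when (p a) (f a))
Σ-filter p []       f = refl
Σ-filter p (x ∷ xs) f with p x
... | true  = cong (f x +_) (Σ-filter p xs f)
... | false = trans (Σ-filter p xs f) (sym (+-identityˡ _))

Σₛ : (Subset n → ℚ) → ℚ
Σₛ {n} f = Σ[ allSubsets n ] f

Σᵇ : (Bool → ℚ) → ℚ
Σᵇ g = g false + g true

Σᵇ-cong : {f g : Bool → ℚ} → (∀ b → f b ≡ g b) → Σᵇ f ≡ Σᵇ g
Σᵇ-cong e = cong₂ _+_ (e false) (e true)

Σₛ-cong : {f g : Subset n → ℚ} → (∀ X → f X ≡ g X) → Σₛ f ≡ Σₛ g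
Σₛ-cong {n} = Σ-cong (allSubsets n)

subsetsWith-Σₛ : (p : Subset n → Bool) (f : Subset n → ℚ) →
  Σ[ subsetsWith n p ] f ≡ Σₛ (λ X → when (p X) (f X))
subsetsWith-Σₛ {n} p f = Σ-filter p (allSubsets n) f

Σₛ-suc : (f : Subset (suc n) → ℚ) → Σₛ f ≡ Σᵇ (λ b → Σₛ (λ X → f (b ∷ X)))
Σₛ-suc {n} f = begin
  Σ[ concatMap (λ X → (false ∷ X) ∷ (true ∷ X) ∷ []) (allSubsets n) ] f
    ≡⟨ Σ-concatMap (λ X → (false ∷ X) ∷ (true ∷ X) ∷ []) (allSubsets n) ⟩
  Σₛ (λ X → f (false ∷ X) + (f (true ∷ X) + 0ℚ))
    ≡⟨ Σₛ-cong (λ X → cong (f (false ∷ X) +_) (+-identityʳ _)) ⟩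
  Σₛ (λ X → f (false ∷ X) + f (true ∷ X))
    ≡⟨ Σ-+ (allSubsets n) (λ X → f (false ∷ X)) (λ X → f (true ∷ X)) ⟩
  Σᵇ (λ b → Σₛ (λ X → f (b ∷ X))) ∎
  where
  open ≡-Reasoning
  Σ-concatMap : ∀ {A : Set} (g : A → List (Subset (suc n))) (xs : List A) →
    Σ[ concatMap g xs ] f ≡ Σ[ xs ] (λ a → Σ[ g a ] f)
  Σ-concatMap g []       = refl
  Σ-concatMap g (x ∷ xs) = trans (Σ-++ (g x) _ f) (cong (Σ[ g x ] f +_) (Σ-concatMap g xs))

Σₛ-when : ∀ b (f : Subset n → ℚ) → Σₛ (λ X → when b (f X)) ≡ when b (Σₛ f)
Σₛ-when {n} true  f = refl
Σₛ-when {n} false f = Σ-zero (allSubsets n)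

Σₛ-Σᵇ : (g : Subset n → Bool → ℚ) → Σₛ (λ X → Σᵇ (g X)) ≡ Σᵇ (λ b → Σₛ (λ X → g X b))
Σₛ-Σᵇ {n} g = Σ-+ (allSubsets n) (λ X → g X false) (λ X → g X true)

Σₛ-factor : {F : Subset (suc n) → ℚ} {F′ : Subset n → ℚ} (φ : Bool → ℚ) →
  (∀ b X → F (b ∷ X) ≡ φ b * F′ X) → Σₛ F ≡ Σᵇ φ * Σₛ F′
Σₛ-factor {n} {F} {F′} φ e = begin
  Σₛ F                                    ≡⟨ Σₛ-suc F ⟩
  Σᵇ (λ b → Σₛ (λ X → F (b ∷ X)))         ≡⟨ cong₂ _+_ (factor false) (factor true) ⟩
  φ false * Σₛ F′ + φ true * Σₛ F′        ≡⟨ *-distribʳ-+ (Σₛ F′) (φ false) (φ true) ⟨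
  Σᵇ φ * Σₛ F′                            ∎
  where
  open ≡-Reasoning
  factor : ∀ b → Σₛ (λ X → F (b ∷ X)) ≡ φ b * Σₛ F′
  factor b = trans (Σₛ-cong (e b)) (Σ-*ˡ (allSubsets n) (φ b) F′)

sg : Bool → ℚ
sg b = if b then - 1ℚ else 1ℚ

sgn-cons : ∀ b (B : Subset n) → sgn ∣ b ∷ B ∣ ≡ sg b * sgn ∣ B ∣
sgn-cons true  B = refl
sgn-cons false B = sym (*-identityˡ _)

Σₛ-delta : (S : Subset n) (g : Subset n → ℚ) → Σₛ (λ A → when (S ≐ A) (g A)) ≡ g S
Σₛ-delta []      g = +-identityʳ (g [])
Σₛ-delta (s ∷ S) g = begin
  Σₛ (λ A → when ((s ∷ S) ≐ A) (g A))
    ≡⟨ Σₛ-suc (λ A → when ((s ∷ S) ≐ A) (g A)) ⟩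
  Σᵇ (λ a → Σₛ (λ A → when ((s == a) ∧ (S ≐ A)) (g (a ∷ A))))
    ≡⟨ only-s s ⟩
  Σₛ (λ A → when (S ≐ A) (g (s ∷ A)))
    ≡⟨ Σₛ-delta S (λ A → g (s ∷ A)) ⟩
  g (s ∷ S) ∎
  where
  open ≡-Reasoning
  only-s : ∀ s → Σᵇ (λ a → Σₛ (λ A → when ((s == a) ∧ (S ≐ A)) (g (a ∷ A))))
                 ≡ Σₛ (λ A → when (S ≐ A) (g (s ∷ A)))
  only-s true  = trans (cong (_+ Σₛ (λ A → when (S ≐ A) (g (true ∷ A)))) (Σₛ-when false (λ A → g (false ∷ A))))
                       (+-identityˡ _)
  only-s false = trans (cong (Σₛ (λ A → when (S ≐ A) (g (false ∷ A))) +_) (Σₛ-when false (λ A → g (true ∷ A))))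
                       (+-identityʳ _)

Σₛ-split-⊥ : (F : Subset n → ℚ) → Σₛ F ≡ F ⊥ + Σₛ (λ A → when (not (A ≐ ⊥)) (F A))
Σₛ-split-⊥ {zero}  F = refl
Σₛ-split-⊥ {suc n} F = begin
  Σₛ F                                        ≡⟨ Σₛ-suc F ⟩
  Σₛ (λ A → F (false ∷ A)) + Σₛ (λ A → F (true ∷ A))
    ≡⟨ cong (_+ Σₛ (λ A → F (true ∷ A))) (Σₛ-split-⊥ (λ A → F (false ∷ A))) ⟩
  (F ⊥ + Σₛ (λ A → when (not (A ≐ ⊥)) (F (false ∷ A)))) + Σₛ (λ A → F (true ∷ A))
    ≡⟨ +-assoc (F ⊥) (Σₛ (λ A → when (not (A ≐ ⊥)) (F (false ∷ A)))) (Σₛ (λ A → F (true ∷ A))) ⟩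
  F ⊥ + Σᵇ (λ b → Σₛ (λ A → when (not ((b ∷ A) ≐ ⊥)) (F (b ∷ A))))
    ≡⟨ cong (F ⊥ +_) (Σₛ-suc (λ A → when (not (A ≐ ⊥)) (F A))) ⟨
  F ⊥ + Σₛ (λ A → when (not (A ≐ ⊥)) (F A)) ∎
  where open ≡-Reasoning

when-factor₃ : ∀ l₁ t₁ l₂ t₂ l₃ t₃ c v →
  when (l₁ ∧ t₁) (when (l₂ ∧ t₂) (when (l₃ ∧ t₃) (c * v)))
    ≡ when l₁ (when l₂ (when l₃ c)) * when t₁ (when t₂ (when t₃ v))
when-factor₃ l₁ t₁ l₂ t₂ l₃ t₃ c v = begin
  when (l₁ ∧ t₁) (when (l₂ ∧ t₂) (when (l₃ ∧ t₃) (c * v)))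
    ≡⟨ cong (λ q → when (l₁ ∧ t₁) (when (l₂ ∧ t₂) q)) (when-factor l₃ t₃ c v) ⟩
  when (l₁ ∧ t₁) (when (l₂ ∧ t₂) (when l₃ c * when t₃ v))
    ≡⟨ cong (when (l₁ ∧ t₁)) (when-factor l₂ t₂ (when l₃ c) (when t₃ v)) ⟩
  when (l₁ ∧ t₁) (when l₂ (when l₃ c) * when t₂ (when t₃ v))
    ≡⟨ when-factor l₁ t₁ _ _ ⟩
  when l₁ (when l₂ (when l₃ c)) * when t₁ (when t₂ (when t₃ v)) ∎
  where open ≡-Reasoning

when-split₃ : ∀ l₁ t₁ l₂ t₂ l₃ t₃ v →
  when (l₁ ∧ t₁) (when (l₂ ∧ t₂) (when (l₃ ∧ t₃) v))
    ≡ when (l₁ ∧ (l₂ ∧ l₃)) (when t₁ (when t₂ (when t₃ v)))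
when-split₃ false t₁ l₂    t₂ l₃    t₃ v = refl
when-split₃ true  t₁ false t₂ l₃    t₃ v = when-zero t₁
when-split₃ true  t₁ true  t₂ false t₃ v = when₂-zero t₁ t₂
when-split₃ true  t₁ true  t₂ true  t₃ v = refl

ieTerm : Subset n → Subset n → Subset n → Subset n → ℚ
ieTerm U A Y B = when (B ⊆? U) (when (U ─ A ⊆? B) (when (Y ∩ B ≐ ⊥) (sgn ∣ B ∣)))

inclusion–exclusion : (U A Y : Subset n) →
  Σₛ (ieTerm U A Y) ≡ when (Y ∩ U ≐ A ∩ U) (sgn ∣ U ─ A ∣)
inclusion–exclusion []      []      []      = refl
inclusion–exclusion (u ∷ U) (a ∷ A) (y ∷ Y) = begin
  Σₛ (ieTerm (u ∷ U) (a ∷ A) (y ∷ Y))       ≡⟨ Σₛ-factor {F = ieTerm (u ∷ U) (a ∷ A) (y ∷ Y)} {F′ = ieTerm U A Y} local split ⟩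
  Σᵇ local * Σₛ (ieTerm U A Y)              ≡⟨ cong₂ _*_ (local-sum u a y) (inclusion–exclusion U A Y) ⟩
  when ((y ∧ u) == (a ∧ u)) (sg (u ∧ not a)) * when (Y ∩ U ≐ A ∩ U) (sgn ∣ U ─ A ∣)
    ≡⟨ when-factor ((y ∧ u) == (a ∧ u)) (Y ∩ U ≐ A ∩ U) (sg (u ∧ not a)) (sgn ∣ U ─ A ∣) ⟨
  when (((y ∧ u) == (a ∧ u)) ∧ (Y ∩ U ≐ A ∩ U)) (sg (u ∧ not a) * sgn ∣ U ─ A ∣)
    ≡⟨ cong (when _) (trans (cong (λ D → sgn ∣ D ∣) (─-cons u a U A)) (sgn-cons (u ∧ not a) (U ─ A))) ⟨
  when (((y ∧ u) == (a ∧ u)) ∧ (Y ∩ U ≐ A ∩ U)) (sgn ∣ (u ∷ U) ─ (a ∷ A) ∣) ∎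
  where
  open ≡-Reasoning
  local : Bool → ℚ
  local b = when (not b ∨ u) (when (not (u ∧ not a) ∨ b) (when ((y ∧ b) == false) (sg b)))
  split : ∀ b B → ieTerm (u ∷ U) (a ∷ A) (y ∷ Y) (b ∷ B) ≡ local b * ieTerm U A Y B
  split b B = trans
    (cong₂ (λ D s → when (b ∷ B ⊆? u ∷ U) (when (D ⊆? b ∷ B) (when ((y ∷ Y) ∩ (b ∷ B) ≐ ⊥) s)))
           (─-cons u a U A) (sgn-cons b B))
    (when-factor₃ (not b ∨ u) (B ⊆? U) (not (u ∧ not a) ∨ b) (U ─ A ⊆? B)
                  ((y ∧ b) == false) (Y ∩ B ≐ ⊥) (sg b) (sgn ∣ B ∣))
  local-sum : ∀ u a y → Σᵇ (λ b → when (not b ∨ u) (when (not (u ∧ not a) ∨ b) (when ((y ∧ b) == false) (sg b))))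
                        ≡ when ((y ∧ u) == (a ∧ u)) (sg (u ∧ not a))
  local-sum true  true  true  = refl
  local-sum true  true  false = refl
  local-sum true  false true  = refl
  local-sum true  false false = refl
  local-sum false true  true  = refl
  local-sum false true  false = refl
  local-sum false false true  = refl
  local-sum false false false = refl

onAgreeingPairs : Subset n → Subset n → Subset n → Subset n → ℚ → ℚ
onAgreeingPairs VH VK Y Z q =
  when (Y ⊆? VH) (when (Z ⊆? VK) (when (Y ∩ (VH ∩ VK) ≐ Z ∩ (VH ∩ VK)) q))

agreeing-bits : ∀ h k (R : Bool → Bool → ℚ) →
  Σᵇ (λ y → Σᵇ (λ z → when ((not y ∨ h) ∧ ((not z ∨ k) ∧ ((y ∧ (h ∧ k)) == (z ∧ (h ∧ k))))) (R y z)))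
    ≡ Σᵇ (λ x → when (not x ∨ (h ∨ k)) (R (x ∧ h) (x ∧ k)))
agreeing-bits true  true  R = cong₂ _+_ (+-identityʳ (R false false)) (+-identityˡ (R true true))
agreeing-bits true  false R = cong₂ _+_ (+-identityʳ (R false false)) (+-identityʳ (R true false))
agreeing-bits false true  R = +-identityʳ (R false false + R false true)
agreeing-bits false false R = +-identityʳ (R false false + 0ℚ)

-- A subset X of VH ∪ VK is the same as an agreeing pair (Y, Z), namely
-- Y = X ∩ VH and Z = X ∩ VK; so sums over either range coincide.
Σₛ-union : (VH VK : Subset n) (Φ : Subset n → Subset n → ℚ) →
  Σₛ (λ Y → Σₛ (λ Z → onAgreeingPairs VH VK Y Z (Φ Y Z)))
    ≡ Σₛ (λ X → when (X ⊆? VH ∪ VK) (Φ (X ∩ VH) (X ∩ VK)))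
Σₛ-union []       []       Φ = +-identityʳ (Φ [] [] + 0ℚ)
Σₛ-union {suc n} (h ∷ VH) (k ∷ VK) Φ = begin
  Σₛ (λ Y → Σₛ (ψ Y))
    ≡⟨ Σₛ-suc (λ Y → Σₛ (ψ Y)) ⟩
  Σᵇ (λ y → Σₛ (λ Y → Σₛ (ψ (y ∷ Y))))
    ≡⟨ Σᵇ-cong (λ y → trans (Σₛ-cong (λ Y → Σₛ-suc (ψ (y ∷ Y))))
                             (Σₛ-Σᵇ (λ Y z → Σₛ (λ Z → ψ (y ∷ Y) (z ∷ Z))))) ⟩
  Σᵇ (λ y → Σᵇ (λ z → Σₛ (λ Y → Σₛ (λ Z → ψ (y ∷ Y) (z ∷ Z)))))
    ≡⟨ Σᵇ-cong (λ y → Σᵇ-cong (λ z → peel y z)) ⟩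
  Σᵇ (λ y → Σᵇ (λ z → when (agree y z) (Σₛ (λ Y → Σₛ (ψ′ y z Y)))))
    ≡⟨ Σᵇ-cong (λ y → Σᵇ-cong (λ z → cong (when (agree y z)) (Σₛ-union VH VK (λ Y Z → Φ (y ∷ Y) (z ∷ Z))))) ⟩
  Σᵇ (λ y → Σᵇ (λ z → when (agree y z) (rest y z)))
    ≡⟨ agreeing-bits h k rest ⟩
  Σᵇ (λ x → when (not x ∨ (h ∨ k)) (rest (x ∧ h) (x ∧ k)))
    ≡⟨ Σᵇ-cong unpeel ⟩
  Σᵇ (λ x → Σₛ (λ X → χ (x ∷ X)))
    ≡⟨ Σₛ-suc χ ⟨
  Σₛ χ ∎
  where
  open ≡-Reasoning
  ψ : Subset (suc n) → Subset (suc n) → ℚ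
  ψ Y Z = onAgreeingPairs (h ∷ VH) (k ∷ VK) Y Z (Φ Y Z)
  ψ′ : Bool → Bool → Subset n → Subset n → ℚ
  ψ′ y z Y Z = onAgreeingPairs VH VK Y Z (Φ (y ∷ Y) (z ∷ Z))
  χ : Subset (suc n) → ℚ
  χ X = when (X ⊆? (h ∷ VH) ∪ (k ∷ VK)) (Φ (X ∩ (h ∷ VH)) (X ∩ (k ∷ VK)))
  agree : Bool → Bool → Bool
  agree y z = (not y ∨ h) ∧ ((not z ∨ k) ∧ ((y ∧ (h ∧ k)) == (z ∧ (h ∧ k))))
  rest : Bool → Bool → ℚ
  rest y z = Σₛ (λ X → when (X ⊆? VH ∪ VK) (Φ (y ∷ (X ∩ VH)) (z ∷ (X ∩ VK))))
  peel : ∀ y z → Σₛ (λ Y → Σₛ (λ Z → ψ (y ∷ Y) (z ∷ Z))) ≡ when (agree y z) (Σₛ (λ Y → Σₛ (ψ′ y z Y)))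
  peel y z = begin
    Σₛ (λ Y → Σₛ (λ Z → ψ (y ∷ Y) (z ∷ Z)))
      ≡⟨ Σₛ-cong (λ Y → Σₛ-cong (λ Z → when-split₃ (not y ∨ h) (Y ⊆? VH) (not z ∨ k) (Z ⊆? VK)
                                          ((y ∧ (h ∧ k)) == (z ∧ (h ∧ k))) (Y ∩ (VH ∩ VK) ≐ Z ∩ (VH ∩ VK))
                                          (Φ (y ∷ Y) (z ∷ Z)))) ⟩
    Σₛ (λ Y → Σₛ (λ Z → when (agree y z) (ψ′ y z Y Z)))
      ≡⟨ Σₛ-cong (λ Y → Σₛ-when (agree y z) (ψ′ y z Y)) ⟩
    Σₛ (λ Y → when (agree y z) (Σₛ (ψ′ y z Y)))
      ≡⟨ Σₛ-when (agree y z) (λ Y → Σₛ (ψ′ y z Y)) ⟩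
    when (agree y z) (Σₛ (λ Y → Σₛ (ψ′ y z Y))) ∎
  unpeel : ∀ x → when (not x ∨ (h ∨ k)) (rest (x ∧ h) (x ∧ k)) ≡ Σₛ (λ X → χ (x ∷ X))
  unpeel x = trans (sym (Σₛ-when (not x ∨ (h ∨ k)) (λ X → when (X ⊆? VH ∪ VK) (Φ ((x ∧ h) ∷ (X ∩ VH)) ((x ∧ k) ∷ (X ∩ VK))))))
                   (Σₛ-cong (λ X → sym (when-∧ (not x ∨ (h ∨ k)) (X ⊆? VH ∪ VK) _)))
Σₛ-by-trace : (U : Subset n) (f : Subset n → ℚ) →
  Σₛ f ≡ Σₛ (λ A → when (A ⊆? U) (Σₛ (λ X → when (X ∩ U ≐ A) (f X))))
Σₛ-by-trace {n} U f = sym (begin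
  Σₛ (λ A → when (A ⊆? U) (Σₛ (λ X → when (X ∩ U ≐ A) (f X))))
    ≡⟨ Σₛ-cong (λ A → sym (Σₛ-when (A ⊆? U) (λ X → when (X ∩ U ≐ A) (f X)))) ⟩
  Σₛ (λ A → Σₛ (λ X → when (A ⊆? U) (when (X ∩ U ≐ A) (f X))))
    ≡⟨ Σ-swap (allSubsets n) (allSubsets n) (λ A X → when (A ⊆? U) (when (X ∩ U ≐ A) (f X))) ⟩
  Σₛ (λ X → Σₛ (λ A → when (A ⊆? U) (when (X ∩ U ≐ A) (f X))))
    ≡⟨ Σₛ-cong (λ X → Σₛ-cong (λ A → when-comm (A ⊆? U) (X ∩ U ≐ A) (f X))) ⟩
  Σₛ (λ X → Σₛ (λ A → when (X ∩ U ≐ A) (when (A ⊆? U) (f X))))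
    ≡⟨ Σₛ-cong (λ X → Σₛ-delta (X ∩ U) (λ A → when (A ⊆? U) (f X))) ⟩
  Σₛ (λ X → when (X ∩ U ⊆? U) (f X))
    ≡⟨ Σₛ-cong (λ X → cong (λ b → when b (f X)) (∩-⊆? X U)) ⟩
  Σₛ f ∎)
  where open ≡-Reasoning

bit : Bool → ℕ
bit b = if b then 1 else 0

count-tabulate : ∀ {A : Set} (q : A → Bool) (f : Fin n → A) →
  List.length (List.filter (λ a → q a ≟ᵇ true) (List.tabulate f)) ≡ countFin (q ∘ f)
count-tabulate {zero}  q f = refl
count-tabulate {suc n} q f with q (f fzero)
... | true  = cong suc (trans (count-tabulate q (f ∘ fsuc)) (sym (count-tabulate (q ∘ f) fsuc)))
... | false = trans (count-tabulate q (f ∘ fsuc)) (sym (count-tabulate (q ∘ f) fsuc))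

countFin-suc : (p : Fin (suc n) → Bool) → countFin p ≡ bit (p fzero) +ℕ countFin (p ∘ fsuc)
countFin-suc p with p fzero
... | true  = cong suc (count-tabulate p fsuc)
... | false = count-tabulate p fsuc

countFin-cong : {p q : Fin n → Bool} → (∀ i → p i ≡ q i) → countFin p ≡ countFin q
countFin-cong {zero}          e = refl
countFin-cong {suc n} {p} {q} e =
  trans (countFin-suc p) (trans (cong₂ (λ b c → bit b +ℕ c) (e fzero) (countFin-cong (e ∘ fsuc)))
                                (sym (countFin-suc q)))

countFin-pointwise : (p q r s : Fin n → Bool) →
  (∀ i → bit (p i) +ℕ bit (q i) ≡ bit (r i) +ℕ bit (s i)) →
  countFin p +ℕ countFin q ≡ countFin r +ℕ countFin s
countFin-pointwise {zero}  p q r s e = refl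
countFin-pointwise {suc n} p q r s e = begin
  countFin p +ℕ countFin q
    ≡⟨ cong₂ _+ℕ_ (countFin-suc p) (countFin-suc q) ⟩
  (bit (p fzero) +ℕ countFin (p ∘ fsuc)) +ℕ (bit (q fzero) +ℕ countFin (q ∘ fsuc))
    ≡⟨ ℕ-+-interchange (bit (p fzero)) _ _ _ ⟩
  (bit (p fzero) +ℕ bit (q fzero)) +ℕ (countFin (p ∘ fsuc) +ℕ countFin (q ∘ fsuc))
    ≡⟨ cong₂ _+ℕ_ (e fzero) (countFin-pointwise (p ∘ fsuc) (q ∘ fsuc) (r ∘ fsuc) (s ∘ fsuc) (e ∘ fsuc)) ⟩
  (bit (r fzero) +ℕ bit (s fzero)) +ℕ (countFin (r ∘ fsuc) +ℕ countFin (s ∘ fsuc))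
    ≡⟨ ℕ-+-interchange (bit (r fzero)) _ _ _ ⟩
  (bit (r fzero) +ℕ countFin (r ∘ fsuc)) +ℕ (bit (s fzero) +ℕ countFin (s ∘ fsuc))
    ≡⟨ cong₂ _+ℕ_ (countFin-suc r) (countFin-suc s) ⟨
  countFin r +ℕ countFin s ∎
  where open ≡-Reasoning

countFin-none : (p : Fin n → Bool) → (∀ i → p i ≡ false) → countFin p ≡ 0
countFin-none {n} p none = trans (countFin-cong none) (count-false n)
  where
  count-false : ∀ m → countFin {m} (λ _ → false) ≡ 0
  count-false zero    = refl
  count-false (suc m) = trans (countFin-suc {m} (λ _ → false)) (count-false m)

countFin-split : (c p : Fin n → Bool) →
  countFin p ≡ countFin (λ i → c i ∧ p i) +ℕ countFin (λ i → not (c i) ∧ p i)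
countFin-split {n} c p = begin
  countFin p                        ≡⟨ ℕ.+-identityʳ _ ⟨
  countFin p +ℕ 0                   ≡⟨ cong (countFin p +ℕ_) (countFin-none {n} (λ _ → false) (λ _ → refl)) ⟨
  countFin p +ℕ countFin {n} (λ _ → false)
    ≡⟨ countFin-pointwise p (λ _ → false) (λ i → c i ∧ p i) (λ i → not (c i) ∧ p i) (λ i → by-cases (c i) (p i)) ⟩
  countFin (λ i → c i ∧ p i) +ℕ countFin (λ i → not (c i) ∧ p i) ∎
  where
  open ≡-Reasoning
  by-cases : ∀ a b → bit b +ℕ 0 ≡ bit (a ∧ b) +ℕ bit (not a ∧ b)
  by-cases true  true  = refl
  by-cases true  false = refl
  by-cases false true  = refl
  by-cases false false = refl

countFin-unique : (p : Fin n → Bool) → (∃ λ i → p i ≡ true) →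
  (∀ i j → p i ≡ true → p j ≡ true → i ≡ j) → countFin p ≡ 1
countFin-unique {suc n} p (fzero , p0) unique = begin
  countFin p                             ≡⟨ countFin-suc p ⟩
  bit (p fzero) +ℕ countFin (p ∘ fsuc)   ≡⟨ cong₂ (λ b c → bit b +ℕ c) p0 (countFin-none (p ∘ fsuc) others) ⟩
  1 ∎
  where
  open ≡-Reasoning
  others : ∀ i → p (fsuc i) ≡ false
  others i with p (fsuc i) in pi
  ... | true  with () ← unique fzero (fsuc i) p0 pi
  ... | false = refl
countFin-unique {suc n} p (fsuc i , pi) unique = begin
  countFin p                             ≡⟨ countFin-suc p ⟩
  bit (p fzero) +ℕ countFin (p ∘ fsuc)
    ≡⟨ cong₂ (λ b c → bit b +ℕ c) first
         (countFin-unique (p ∘ fsuc) (i , pi) (λ a b pa pb → Fin.suc-injective (unique (fsuc a) (fsuc b) pa pb))) ⟩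
  1 ∎
  where
  open ≡-Reasoning
  first : p fzero ≡ false
  first with p fzero in p0
  ... | true  with () ← unique fzero (fsuc i) p0 pi
  ... | false = refl

grow : ∀ {m} (R S : Subset m) → (∀ i → i ∈ᵇ R ≡ true → i ∈ᵇ S ≡ true) → R ≡ S ⊎ ∣ R ∣ ℕ.< ∣ S ∣
grow []      []      R⊆S = inj₁ refl
grow (r ∷ R) (s ∷ S) R⊆S with grow R S (λ i → R⊆S (fsuc i)) | r | s | R⊆S fzero
... | inj₁ refl | true  | true  | _ = inj₁ refl
... | inj₁ refl | false | false | _ = inj₁ refl
... | inj₁ refl | false | true  | _ = inj₂ ℕ.≤-refl
... | inj₂ R<S  | true  | true  | _ = inj₂ (s≤s R<S)
... | inj₂ R<S  | false | false | _ = inj₂ R<S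
... | inj₂ R<S  | false | true  | _ = inj₂ (ℕ.m≤n⇒m≤1+n R<S)
... | _         | true  | false | r⇒s with () ← r⇒s refl

module Reachability {n} (G : Graph n) where

  reach-start : ∀ {u v} → Reach G u v → u ∈ V G
  reach-start (here u∈G)     = u∈G
  reach-start (step u∈G _ _) = u∈G

  reach-end : ∀ {u v} → Reach G u v → v ∈ V G
  reach-end (here v∈G)   = v∈G
  reach-end (step _ _ r) = reach-end r

  reach-snoc : ∀ {u w v} → Reach G u w → E G w v ≡ true → v ∈ V G → Reach G u v
  reach-snoc (here w∈G)     e v∈G = step w∈G e (here v∈G)
  reach-snoc (step u∈G e′ r) e v∈G = step u∈G e′ (reach-snoc r e v∈G)

  reach-++ : ∀ {u w v} → Reach G u w → Reach G w v → Reach G u v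
  reach-++ (here _)       r′ = r′
  reach-++ (step u∈G e r) r′ = step u∈G e (reach-++ r r′)

  reach-reverse : (∀ a b → E G a b ≡ E G b a) → ∀ {u v} → Reach G u v → Reach G v u
  reach-reverse sym-E (here u∈G) = here u∈G
  reach-reverse sym-E (step {u} {w} u∈G e r) = reach-snoc (reach-reverse sym-E r) (trans (sym-E w u) e) u∈G

  expand-lookup : ∀ R w →
    w ∈ᵇ expand G R ≡ (w ∈ᵇ R) ∨ ((w ∈ᵇ V G) ∧ anyFin (λ u → (u ∈ᵇ R) ∧ E G u w))
  expand-lookup R w = lookup∘tabulate _ w

  expand-⊇ : ∀ R w → w ∈ᵇ R ≡ true → w ∈ᵇ expand G R ≡ true
  expand-⊇ R w e = trans (expand-lookup R w) (∨-introˡ _ e)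

  iter-start : ∀ v m → v ∈ᵇ iter m G ⁅ v ⁆ ≡ true
  iter-start v zero    = ∈⇒ᵇ (x∈⁅x⁆ v)
  iter-start v (suc m) = expand-⊇ (iter m G ⁅ v ⁆) v (iter-start v m)

  iter-sound : ∀ {v} → v ∈ V G → ∀ m w → w ∈ᵇ iter m G ⁅ v ⁆ ≡ true → Reach G v w
  iter-sound {v} v∈G zero w e with x∈⁅y⁆⇒x≡y v (ᵇ⇒∈ e)
  ... | refl = here v∈G
  iter-sound {v} v∈G (suc m) w e with ∨-true (trans (sym (expand-lookup (iter m G ⁅ v ⁆) w)) e)
  ... | inj₁ old = iter-sound v∈G m w old
  ... | inj₂ new with ∧-true new
  ...   | w∈G , edge-in with anyFin-witness (λ u → (u ∈ᵇ iter m G ⁅ v ⁆) ∧ E G u w) edge-in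
  ...     | u , uw with ∧-true uw
  ...       | u-old , e = reach-snoc (iter-sound v∈G m u u-old) e (ᵇ⇒∈ w∈G)

  -- Each round either adds a vertex or has reached a fixed point; since there
  -- are only n vertices, n rounds reach the fixed point.
  iter-grows : ∀ v m → expand G (iter m G ⁅ v ⁆) ≡ iter m G ⁅ v ⁆ ⊎ m ℕ.< ∣ iter m G ⁅ v ⁆ ∣
  iter-grows v zero    = inj₂ (ℕ.≤-reflexive (sym (∣⁅x⁆∣≡1 v)))
  iter-grows v (suc m) with iter-grows v m
  ... | inj₁ fixed = inj₁ (cong (expand G) fixed)
  ... | inj₂ m<∣R∣ with grow (iter m G ⁅ v ⁆) (expand G (iter m G ⁅ v ⁆)) (expand-⊇ (iter m G ⁅ v ⁆))
  ...   | inj₁ same = inj₁ (cong (expand G) (sym same))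
  ...   | inj₂ bigger = inj₂ (ℕ.≤-<-trans m<∣R∣ bigger)

  comp-closed : ∀ v → expand G (comp G v) ≡ comp G v
  comp-closed v with iter-grows v n
  ... | inj₁ fixed = fixed
  ... | inj₂ n<∣R∣ = ⊥-elim (ℕ.<-irrefl refl (ℕ.<-≤-trans n<∣R∣ (∣p∣≤n (comp G v))))

  closed-reach : ∀ R → expand G R ≡ R → ∀ {u w} → u ∈ᵇ R ≡ true → Reach G u w → w ∈ᵇ R ≡ true
  closed-reach R closed u∈R (here _) = u∈R
  closed-reach R closed {u} u∈R (step {w = w′} _ e r) = closed-reach R closed w′∈R r
    where
    w′∈R : w′ ∈ᵇ R ≡ true
    w′∈R = trans (cong (w′ ∈ᵇ_) (sym closed))
             (trans (expand-lookup R w′)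
               (∨-introʳ _ (∧-intro (∈⇒ᵇ (reach-start r))
                 (anyFin-intro (λ v → (v ∈ᵇ R) ∧ E G v w′) u (∧-intro u∈R e)))))

  comp-complete : ∀ {v w} → Reach G v w → w ∈ᵇ comp G v ≡ true
  comp-complete {v} r = closed-reach (comp G v) (comp-closed v) (iter-start v n) r

  comp-sound : ∀ {v w} → v ∈ V G → w ∈ᵇ comp G v ≡ true → Reach G v w
  comp-sound v∈G = iter-sound v∈G n _

  IsRep : Fin n → Set
  IsRep v = v ∈ V G × (∀ w → w Fin.< v → ¬ Reach G v w)

  private
    smaller-in-comp : Fin n → Fin n → Bool
    smaller-in-comp v w = ⌊ w <? v ⌋ ∧ (w ∈ᵇ comp G v)

    <?-true : ∀ {w v : Fin n} → w Fin.< v → ⌊ w <? v ⌋ ≡ true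
    <?-true {w} {v} w<v with w <? v
    ... | yes _   = refl
    ... | no  w≮v = ⊥-elim (w≮v w<v)

    <?-sound : ∀ {w v : Fin n} → ⌊ w <? v ⌋ ≡ true → w Fin.< v
    <?-sound {w} {v} e with w <? v
    ... | yes w<v = w<v

  isRep-sound : ∀ v → isRep G v ≡ true → IsRep v
  isRep-sound v e with ∧-true e
  ... | v∈G , no-smaller = ᵇ⇒∈ v∈G , λ w w<v r →
    true≢false (anyFin-intro (smaller-in-comp v) w (∧-intro (<?-true w<v) (comp-complete r)))
               (not-true no-smaller)

  isRep-complete : ∀ v → IsRep v → isRep G v ≡ true
  isRep-complete v (v∈G , minimal) = ∧-intro (∈⇒ᵇ v∈G) no-smaller
    where
    no-smaller : not (anyFin (smaller-in-comp v)) ≡ true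
    no-smaller with anyFin (smaller-in-comp v) in found
    ... | false = refl
    ... | true with anyFin-witness (smaller-in-comp v) found
    ...   | w , hit with ∧-true hit
    ...     | w<v , w∈c = ⊥-elim (minimal w (<?-sound w<v) (comp-sound v∈G w∈c))

  isRep-outside : ∀ v → v ∈ᵇ V G ≡ false → isRep G v ≡ false
  isRep-outside v v∉G rewrite v∉G = refl

  descend : ∀ v → v ∈ V G → isRep G v ≡ false → ∃ λ w → w Fin.< v × Reach G v w
  descend v v∈G not-rep with anyFin (smaller-in-comp v) in found
  ... | false = true≢false (∧-intro (∈⇒ᵇ v∈G) refl) not-rep
  ... | true with anyFin-witness (smaller-in-comp v) found
  ...   | w , hit with ∧-true hit
  ...     | w<v , w∈c = w , <?-sound w<v , comp-sound v∈G w∈c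

  module _ (sym-E : ∀ a b → E G a b ≡ E G b a) where

    reach-rep : ∀ a → a ∈ V G → ∃ λ r → isRep G r ≡ true × Reach G a r
    reach-rep a a∈G = go a (Fin.<-wellFounded a) (here a∈G)
      where
      go : ∀ v → Acc Fin._<_ v → Reach G a v → ∃ λ r → isRep G r ≡ true × Reach G a r
      go v (acc smaller) a→v with isRep G v in rep
      ... | true  = v , rep , a→v
      ... | false with descend v (reach-end a→v) rep
      ...   | w , w<v , v→w = go w (smaller w<v) (reach-++ a→v v→w)

    one-rep-per-comp : ∀ a → a ∈ V G → countFin (λ v → (v ∈ᵇ comp G a) ∧ isRep G v) ≡ 1
    one-rep-per-comp a a∈G = countFin-unique _ exists unique
      where
      exists : ∃ λ r → ((r ∈ᵇ comp G a) ∧ isRep G r) ≡ true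
      exists with reach-rep a a∈G
      ... | r , rep , a→r = r , ∧-intro (comp-complete a→r) rep
      linked : ∀ i j → i ∈ᵇ comp G a ≡ true → j ∈ᵇ comp G a ≡ true → Reach G i j
      linked i j i∈c j∈c = reach-++ (reach-reverse sym-E (comp-sound a∈G i∈c)) (comp-sound a∈G j∈c)
      unique : ∀ i j → ((i ∈ᵇ comp G a) ∧ isRep G i) ≡ true → ((j ∈ᵇ comp G a) ∧ isRep G j) ≡ true → i ≡ j
      unique i j ri rj with ∧-true ri | ∧-true rj
      ... | i∈c , i-rep | j∈c , j-rep with Fin.<-cmp i j
      ...   | tri< i<j _ _ = ⊥-elim (proj₂ (isRep-sound j j-rep) i i<j (linked j i j∈c i∈c))
      ...   | tri≈ _ i≡j _ = i≡j
      ...   | tri> _ _ j<i = ⊥-elim (proj₂ (isRep-sound i i-rep) j j<i (linked i j i∈c j∈c))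

OverlapClique : Graph n → Graph n → Set
OverlapClique H K = ∀ u w → u ∈ V H → u ∈ V K → w ∈ V H → w ∈ V K → u ≢ w →
  E H u w ≡ true × E K u w ≡ true

module OneSide {n} (G H K : Graph n) (simple-H : SimpleGraph H) (simple-K : SimpleGraph K)
  (V-G : ∀ u → u ∈ᵇ V G ≡ (u ∈ᵇ V H) ∨ (u ∈ᵇ V K))
  (E-G : ∀ u w → E G u w ≡ E H u w ∨ E K u w)
  (clique : OverlapClique H K) where

  open Reachability

  sym-G : ∀ x y → E G x y ≡ E G y x
  sym-G x y = trans (E-G x y) (trans (cong₂ _∨_ (proj₁ simple-H x y) (proj₁ simple-K x y)) (sym (E-G y x)))

  H⊆G : ∀ {u} → u ∈ V H → u ∈ V G
  H⊆G {u} u∈H = ᵇ⇒∈ (trans (V-G u) (∨-introˡ _ (∈⇒ᵇ u∈H)))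

  lift : ∀ {u v} → Reach H u v → Reach G u v
  lift (here u∈H)     = here (H⊆G u∈H)
  lift (step {u} {w} u∈H e r) = step (H⊆G u∈H) (trans (E-G u w) (∨-introˡ _ e)) (lift r)

  InBoth : Fin n → Set
  InBoth u = u ∈ V H × u ∈ V K

  Touches : Fin n → Set
  Touches v = ∃ λ a → InBoth a × Reach G v a

  both-linked : ∀ {a b} → InBoth a → InBoth b → Reach H a b
  both-linked {a} {b} (a∈H , a∈K) (b∈H , b∈K) with a Fin.≟ b
  ... | yes refl = here a∈H
  ... | no  a≢b  = step a∈H (proj₁ (clique a b a∈H a∈K b∈H b∈K a≢b)) (here b∈H)

  stay-or-meet : ∀ {u w} → u ∈ V H → Reach G u w → Reach H u w ⊎ ∃ λ a → InBoth a × Reach H u a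
  stay-or-meet u∈H (here _) = inj₁ (here u∈H)
  stay-or-meet {u} u∈H (step {w = x} _ e r) with ∨-true (trans (sym (E-G u x)) e)
  ... | inj₂ in-K = inj₂ (u , (u∈H , proj₁ (proj₂ (proj₂ simple-K) u x in-K)) , here u∈H)
  ... | inj₁ in-H with stay-or-meet (proj₂ (proj₂ (proj₂ simple-H) u x in-H)) r
  ...   | inj₁ x→w            = inj₁ (step u∈H in-H x→w)
  ...   | inj₂ (a , a∈ , x→a) = inj₂ (a , a∈ , step u∈H in-H x→a)

  rep-agrees : ∀ v → v ∈ V H → ¬ Touches v → isRep G v ≡ isRep H v
  rep-agrees v v∈H far = bool-ext
    (λ rep-G → isRep-complete H v (v∈H , λ w w<v r → proj₂ (isRep-sound G v rep-G) w w<v (lift r)))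
    (λ rep-H → isRep-complete G v (H⊆G v∈H , λ w w<v r →
       [ proj₂ (isRep-sound H v rep-H) w w<v
       , (λ { (a , a∈ , v→a) → far (a , a∈ , lift v→a) }) ]′ (stay-or-meet v∈H r)))

  reps-of-H-near : ∀ a → InBoth a → countFin (λ v → (v ∈ᵇ comp G a) ∧ isRep H v) ≡ 1
  reps-of-H-near a a∈ = trans (countFin-cong same-comp)
                              (one-rep-per-comp H (proj₁ simple-H) a (proj₁ a∈))
    where
    same-comp : ∀ v → ((v ∈ᵇ comp G a) ∧ isRep H v) ≡ ((v ∈ᵇ comp H a) ∧ isRep H v)
    same-comp v = bool-ext
      (λ near-G → let (v∈c , rep) = ∧-true near-G
                      v∈H = proj₁ (isRep-sound H v rep)
                      v→a = reach-reverse G sym-G (comp-sound G (H⊆G (proj₁ a∈)) v∈c)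
                      v→aᴴ = [ id , (λ { (b , b∈ , v→b) → reach-++ H v→b (both-linked b∈ a∈) }) ]′
                               (stay-or-meet v∈H v→a)
                  in ∧-intro (comp-complete H (reach-reverse H (proj₁ simple-H) v→aᴴ)) rep)
      (λ near-H → let (v∈c , rep) = ∧-true near-H
                  in ∧-intro (comp-complete G (lift (comp-sound H (proj₁ a∈) v∈c))) rep)

module Gluing {n} (G H K : Graph n) (simple-H : SimpleGraph H) (simple-K : SimpleGraph K)
  (union : H ∪ᴳ K ≡ G) (clique : OverlapClique H K) where

  open Reachability

  V-G : ∀ u → u ∈ᵇ V G ≡ (u ∈ᵇ V H) ∨ (u ∈ᵇ V K)
  V-G u = trans (cong (u ∈ᵇ_) (sym (proj₁ union))) (lookup-zipWith _∨_ u (V H) (V K))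

  module Hside = OneSide G H K simple-H simple-K V-G (proj₂ union) clique
  module Kside = OneSide G K H simple-K simple-H (λ u → trans (V-G u) (∨-comm (u ∈ᵇ V H) (u ∈ᵇ V K)))
    (λ u w → trans (proj₂ union u w) (∨-comm (E H u w) (E K u w)))
    (λ u w u∈K u∈H w∈K w∈H u≢w → swap (clique u w u∈H u∈K w∈H w∈K u≢w))

  split-far : ∀ v → ¬ Hside.Touches v → bit (isRep H v) +ℕ bit (isRep K v) ≡ bit (isRep G v)
  split-far v far = by-membership (v ∈ᵇ V H) refl (v ∈ᵇ V K) refl
    where
    open ≡-Reasoning
    by-membership : ∀ h → v ∈ᵇ V H ≡ h → ∀ k → v ∈ᵇ V K ≡ k →
      bit (isRep H v) +ℕ bit (isRep K v) ≡ bit (isRep G v)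
    by-membership true v∈H true v∈K =
      ⊥-elim (far (v , (ᵇ⇒∈ v∈H , ᵇ⇒∈ v∈K) , here (Hside.H⊆G (ᵇ⇒∈ v∈H))))
    by-membership true v∈H false v∉K = begin
      bit (isRep H v) +ℕ bit (isRep K v) ≡⟨ cong (λ b → bit (isRep H v) +ℕ bit b) (isRep-outside K v v∉K) ⟩
      bit (isRep H v) +ℕ 0               ≡⟨ ℕ.+-identityʳ _ ⟩
      bit (isRep H v)                     ≡⟨ cong bit (Hside.rep-agrees v (ᵇ⇒∈ v∈H) far) ⟨
      bit (isRep G v)                     ∎
    by-membership false v∉H true v∈K = begin
      bit (isRep H v) +ℕ bit (isRep K v) ≡⟨ cong (λ b → bit b +ℕ bit (isRep K v)) (isRep-outside H v v∉H) ⟩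
      bit (isRep K v)                     ≡⟨ cong bit (Kside.rep-agrees v (ᵇ⇒∈ v∈K) (λ (a , a∈ , r) → far (a , swap a∈ , r))) ⟨
      bit (isRep G v)                     ∎
    by-membership false v∉H false v∉K = begin
      bit (isRep H v) +ℕ bit (isRep K v) ≡⟨ cong₂ (λ b c → bit b +ℕ bit c) (isRep-outside H v v∉H) (isRep-outside K v v∉K) ⟩
      0                                   ≡⟨ cong bit (isRep-outside G v (trans (V-G v) (cong₂ _∨_ v∉H v∉K))) ⟨
      bit (isRep G v)                     ∎

  disjoint-case : V H ∩ V K ≐ ⊥ ≡ true → components H +ℕ components K ≡ components G +ℕ 0
  disjoint-case no-meet = begin
    countFin (isRep H) +ℕ countFin (isRep K)
      ≡⟨ countFin-pointwise (isRep H) (isRep K) (isRep G) (λ _ → false)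
           (λ v → trans (split-far v (nothing-touches v)) (sym (ℕ.+-identityʳ _))) ⟩
    countFin (isRep G) +ℕ countFin {n} (λ _ → false)
      ≡⟨ cong (countFin (isRep G) +ℕ_) (countFin-none {n} (λ _ → false) (λ _ → refl)) ⟩
    countFin (isRep G) +ℕ 0 ∎
    where
    open ≡-Reasoning
    nothing-touches : ∀ v → ¬ Hside.Touches v
    nothing-touches v (a , (a∈H , a∈K) , _) = true≢false
      (trans (lookup-zipWith _∧_ a (V H) (V K)) (∧-intro (∈⇒ᵇ a∈H) (∈⇒ᵇ a∈K)))
      (trans (cong (a ∈ᵇ_) (≐-sound (V H ∩ V K) ⊥ no-meet)) (lookup-replicate a false))

  -- If they meet in a, the components through a merge into one.
  meeting-case : ∀ a → Hside.InBoth a → components H +ℕ components K ≡ components G +ℕ 1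
  meeting-case a a∈ = begin
    countFin (isRep H) +ℕ countFin (isRep K)
      ≡⟨ cong₂ _+ℕ_ (countFin-split near (isRep H)) (countFin-split near (isRep K)) ⟩
    (inside H +ℕ outside H) +ℕ (inside K +ℕ outside K)
      ≡⟨ cong₂ (λ p q → (p +ℕ outside H) +ℕ (q +ℕ outside K))
               (Hside.reps-of-H-near a a∈) (Kside.reps-of-H-near a (swap a∈)) ⟩
    suc (outside H) +ℕ suc (outside K)
      ≡⟨ cong suc (ℕ.+-suc (outside H) (outside K)) ⟩
    suc (suc (outside H +ℕ outside K))
      ≡⟨ cong (λ m → suc (suc m)) (countFin-pointwise _ _ _ (λ _ → false) far-split) ⟩
    suc (suc (outside G +ℕ countFin {n} (λ _ → false)))
      ≡⟨ cong (λ m → suc (suc (outside G +ℕ m))) (countFin-none {n} (λ _ → false) (λ _ → refl)) ⟩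
    suc (suc (outside G +ℕ 0))
      ≡⟨ cong suc (ℕ.+-suc (outside G) 0) ⟨
    suc (outside G) +ℕ 1
      ≡⟨ cong (λ p → (p +ℕ outside G) +ℕ 1) (one-rep-per-comp G Hside.sym-G a (Hside.H⊆G (proj₁ a∈))) ⟨
    (inside G +ℕ outside G) +ℕ 1
      ≡⟨ cong (_+ℕ 1) (countFin-split near (isRep G)) ⟨
    countFin (isRep G) +ℕ 1 ∎
    where
    open ≡-Reasoning
    near : Fin n → Bool
    near v = v ∈ᵇ comp G a
    inside outside : Graph n → ℕ
    inside  X = countFin (λ v → near v ∧ isRep X v)
    outside X = countFin (λ v → not (near v) ∧ isRep X v)
    far : ∀ v → near v ≡ false → ¬ Hside.Touches v
    far v not-near (b , b∈ , v→b) = true≢false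
      (comp-complete G (reach-reverse G Hside.sym-G (reach-++ G v→b (Hside.lift (Hside.both-linked b∈ a∈)))))
      not-near
    far-split : ∀ v → bit (not (near v) ∧ isRep H v) +ℕ bit (not (near v) ∧ isRep K v)
                      ≡ bit (not (near v) ∧ isRep G v) +ℕ 0
    far-split v with near v in near-v
    ... | true  = refl
    ... | false = trans (split-far v (far v near-v)) (sym (ℕ.+-identityʳ _))

gluing : (G H K : Graph n) → SimpleGraph H → SimpleGraph K → H ∪ᴳ K ≡ G → OverlapClique H K →
  components H +ℕ components K ≡ components G +ℕ bit (not (V H ∩ V K ≐ ⊥))
gluing G H K simple-H simple-K union clique with V H ∩ V K ≐ ⊥ in meet
... | true  = Gluing.disjoint-case G H K simple-H simple-K union clique meet
... | false with ≐⊥-witness (V H ∩ V K) meet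
...   | a , a∈ with ∧-true (trans (sym (lookup-zipWith _∧_ a (V H) (V K))) a∈)
...     | a∈H , a∈K = Gluing.meeting-case G H K simple-H simple-K union clique a (ᵇ⇒∈ a∈H , ᵇ⇒∈ a∈K)

components-cong : (G G′ : Graph n) → V G ≡ V G′ → (∀ u w → E G u w ≡ E G′ u w) →
  components G ≡ components G′
components-cong {n} G G′ same-V same-E = countFin-cong same-rep
  where
  expand-cong : ∀ R → expand G R ≡ expand G′ R
  expand-cong R = tabulate-cong λ w →
    cong₂ (λ S b → (w ∈ᵇ R) ∨ ((w ∈ᵇ S) ∧ b)) same-V (anyFin-cong (λ u → cong ((u ∈ᵇ R) ∧_) (same-E u w)))
  iter-cong : ∀ m R → iter m G R ≡ iter m G′ R
  iter-cong zero    R = refl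
  iter-cong (suc m) R = trans (cong (expand G) (iter-cong m R)) (expand-cong (iter m G′ R))
  same-rep : ∀ v → isRep G v ≡ isRep G′ v
  same-rep v = cong₂ (λ S C → (v ∈ᵇ S) ∧ not (anyFin (λ w → ⌊ w <? v ⌋ ∧ (w ∈ᵇ C))))
                     same-V (iter-cong n ⁅ v ⁆)

module ∩-Solver {n} = ICM (∩-idempotentCommutativeMonoid n)

induced-simple : (H : Graph n) (Y : Subset n) → SimpleGraph H → SimpleGraph (induced H Y)
induced-simple H Y (sym-H , loopless-H , in-H) =
  (λ u w → cong₂ _∧_ (sym-H u w) (∧-comm (u ∈ᵇ Y) (w ∈ᵇ Y))) ,
  (λ u → cong (_∧ ((u ∈ᵇ Y) ∧ (u ∈ᵇ Y))) (loopless-H u)) ,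
  λ u w e → let (e-H , uw∈Y) = ∧-true e
                (u∈Y , w∈Y) = ∧-true uw∈Y
                (u∈H , w∈H) = in-H u w e-H
            in x∈p∩q⁺ (u∈H , ᵇ⇒∈ u∈Y) , x∈p∩q⁺ (w∈H , ᵇ⇒∈ w∈Y)

induced-union : (G H K : Graph n) (X : Subset n) → H ∪ᴳ K ≡ G →
  induced H X ∪ᴳ induced K X ≡ induced G X
induced-union G H K X (V-union , E-G) =
  trans (sym (∩-distribʳ-∪ X (V H) (V K))) (cong (_∩ X) V-union) ,
  λ u w → trans (cong (_∧ ((u ∈ᵇ X) ∧ (w ∈ᵇ X))) (E-G u w)) (∧-distribʳ-∨ _ (E H u w) (E K u w))

induced-clique : (H K Kr : Graph n) (X : Subset n) → H ∩ᴳ K ≡ Kr → Complete Kr →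
  OverlapClique (induced H X) (induced K X)
induced-clique H K Kr X (V-meet , E-Kr) complete u w u∈H′ u∈K′ w∈H′ w∈K′ u≢w =
  in-induced (proj₁ edges) , in-induced (proj₂ edges)
  where
  u∈X = ∈⇒ᵇ (proj₂ (x∈p∩q⁻ (V H) X u∈H′))
  w∈X = ∈⇒ᵇ (proj₂ (x∈p∩q⁻ (V H) X w∈H′))
  in-Kr : ∀ {t} → t ∈ V H ∩ X → t ∈ V K ∩ X → t ∈ V Kr
  in-Kr {t} t∈H′ t∈K′ = subst (t ∈_) V-meet
    (x∈p∩q⁺ (proj₁ (x∈p∩q⁻ (V H) X t∈H′) , proj₁ (x∈p∩q⁻ (V K) X t∈K′)))
  edges : E H u w ≡ true × E K u w ≡ true
  edges = ∧-true (trans (sym (E-Kr u w)) (complete u w (in-Kr u∈H′ u∈K′) (in-Kr w∈H′ w∈K′) u≢w))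
  in-induced : ∀ {e} → e ≡ true → e ∧ ((u ∈ᵇ X) ∧ (w ∈ᵇ X)) ≡ true
  in-induced e = ∧-intro e (∧-intro u∈X w∈X)

induced-meet : (H K : Graph n) (X : Subset n) → V (induced H X) ∩ V (induced K X) ≡ X ∩ (V H ∩ V K)
induced-meet H K X = prove 3 ((h ⊕ x) ⊕ (k ⊕ x)) (x ⊕ (h ⊕ k)) (V H ∷ V K ∷ X ∷ [])
  where
  open ∩-Solver
  h = var fzero
  k = var (fsuc fzero)
  x = var (fsuc (fsuc fzero))

induced-restrict : (H : Graph n) (X : Subset n) → SimpleGraph H →
  components (induced H (X ∩ V H)) ≡ components (induced H X)
induced-restrict H X (_ , _ , in-H) = components-cong _ _
  (prove 2 (h ⊕ (x ⊕ h)) (h ⊕ x) (V H ∷ X ∷ []))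
  same-edges
  where
  open ∩-Solver
  h = var fzero
  x = var (fsuc fzero)
  same-edges : ∀ u w → E H u w ∧ ((u ∈ᵇ (X ∩ V H)) ∧ (w ∈ᵇ (X ∩ V H))) ≡ E H u w ∧ ((u ∈ᵇ X) ∧ (w ∈ᵇ X))
  same-edges u w with E H u w in e
  ... | false = refl
  ... | true  = cong₂ _∧_ (restrict u (proj₁ (in-H u w e))) (restrict w (proj₂ (in-H u w e)))
    where
    restrict : ∀ t → t ∈ V H → t ∈ᵇ (X ∩ V H) ≡ t ∈ᵇ X
    restrict t t∈H = trans (lookup-zipWith _∧_ t X (V H)) (trans (cong ((t ∈ᵇ X) ∧_) (∈⇒ᵇ t∈H)) (∧-identityʳ _))

deleted-induced : (H : Graph n) (B Y : Subset n) → Y ∩ B ≐ ⊥ ≡ true →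
  components (induced (H -ᴳ B) Y) ≡ components (induced H Y)
deleted-induced H B Y avoid = components-cong _ _ (subset-ext same-vertex) same-edges
  where
  outside-B : ∀ t → t ∈ᵇ Y ≡ true → t ∈ᵇ B ≡ false
  outside-B t t∈Y with t ∈ᵇ B in t∈B
  ... | false = refl
  ... | true  = true≢false (trans (lookup-zipWith _∧_ t Y B) (∧-intro t∈Y t∈B))
                           (trans (cong (t ∈ᵇ_) (≐-sound (Y ∩ B) ⊥ avoid)) (lookup-replicate t false))
  same-vertex : ∀ t → t ∈ᵇ ((V H ─ B) ∩ Y) ≡ t ∈ᵇ (V H ∩ Y)
  same-vertex t = begin
    t ∈ᵇ ((V H ─ B) ∩ Y)                      ≡⟨ lookup-zipWith _∧_ t (V H ─ B) Y ⟩
    (t ∈ᵇ (V H ─ B)) ∧ (t ∈ᵇ Y)               ≡⟨ cong (_∧ (t ∈ᵇ Y)) (lookup-─ (V H) B t) ⟩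
    ((t ∈ᵇ V H) ∧ not (t ∈ᵇ B)) ∧ (t ∈ᵇ Y)    ≡⟨ drop-B (t ∈ᵇ Y) refl ⟩
    (t ∈ᵇ V H) ∧ (t ∈ᵇ Y)                     ≡⟨ lookup-zipWith _∧_ t (V H) Y ⟨
    t ∈ᵇ (V H ∩ Y)                            ∎
    where
    open ≡-Reasoning
    drop-B : ∀ y → t ∈ᵇ Y ≡ y → ((t ∈ᵇ V H) ∧ not (t ∈ᵇ B)) ∧ y ≡ (t ∈ᵇ V H) ∧ y
    drop-B true  t∈Y = trans (cong (λ b → ((t ∈ᵇ V H) ∧ not b) ∧ true) (outside-B t t∈Y))
                             (cong (_∧ true) (∧-identityʳ _))
    drop-B false _   = trans (∧-zeroʳ _) (sym (∧-zeroʳ _))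
  same-edges : ∀ u w → (E H u w ∧ not (u ∈ᵇ B) ∧ not (w ∈ᵇ B)) ∧ ((u ∈ᵇ Y) ∧ (w ∈ᵇ Y))
                       ≡ E H u w ∧ ((u ∈ᵇ Y) ∧ (w ∈ᵇ Y))
  same-edges u w with u ∈ᵇ Y in u∈Y | w ∈ᵇ Y in w∈Y
  ... | true  | true  rewrite outside-B u u∈Y | outside-B w w∈Y = cong (_∧ true) (∧-identityʳ (E H u w))
  ... | true  | false = trans (∧-zeroʳ _) (sym (∧-zeroʳ _))
  ... | false | _     = trans (∧-zeroʳ _) (sym (∧-zeroʳ _))

^-+ : ∀ p m k → p ^ (m +ℕ k) ≡ p ^ m * p ^ k
^-+ p zero    k = sym (*-identityˡ _)
^-+ p (suc m) k = trans (cong (p *_) (^-+ p m k)) (sym (*-assoc p (p ^ m) (p ^ k)))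

sgn-+ : ∀ m k → sgn (m +ℕ k) ≡ sgn m * sgn k
sgn-+ = ^-+ (- 1ℚ)

sgn² : ∀ m → sgn m * sgn m ≡ 1ℚ
sgn² zero    = refl
sgn² (suc m) = begin
  (- 1ℚ * sgn m) * (- 1ℚ * sgn m)  ≡⟨ *-interchange (- 1ℚ) (sgn m) (- 1ℚ) (sgn m) ⟩
  (- 1ℚ * - 1ℚ) * (sgn m * sgn m)  ≡⟨ cong (1ℚ *_) (sgn² m) ⟩
  1ℚ ∎
  where
  open ≡-Reasoning

^-inverse : ∀ p .{{_ : NonZero p}} m → (1/ p) ^ m * p ^ m ≡ 1ℚ
^-inverse p zero    = refl
^-inverse p (suc m) = begin
  (1/ p * (1/ p) ^ m) * (p * p ^ m)  ≡⟨ *-interchange (1/ p) _ p _ ⟩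
  (1/ p * p) * ((1/ p) ^ m * p ^ m)  ≡⟨ cong₂ _*_ (*-inverseˡ p) (^-inverse p m) ⟩
  1ℚ ∎
  where
  open ≡-Reasoning

signed-product : (bs cs : List (Subset n)) (f g : Subset n → ℚ) →
  Σ[ bs ] (λ B → Σ[ cs ] (λ C → sgn (∣ B ∣ +ℕ ∣ C ∣) * f B * g C))
    ≡ Σ[ bs ] (λ B → sgn ∣ B ∣ * f B) * Σ[ cs ] (λ C → sgn ∣ C ∣ * g C)
signed-product bs cs f g = sym (trans (Σ-product bs cs (λ B → sgn ∣ B ∣ * f B) (λ C → sgn ∣ C ∣ * g C))
                                      (Σ-cong bs (λ B → Σ-cong cs (λ C → regroup B C))))
  where
  regroup : ∀ B C → (sgn ∣ B ∣ * f B) * (sgn ∣ C ∣ * g C) ≡ sgn (∣ B ∣ +ℕ ∣ C ∣) * f B * g C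
  regroup B C = begin
    (sgn ∣ B ∣ * f B) * (sgn ∣ C ∣ * g C)  ≡⟨ *-interchange (sgn ∣ B ∣) (f B) (sgn ∣ C ∣) (g C) ⟩
    (sgn ∣ B ∣ * sgn ∣ C ∣) * (f B * g C)  ≡⟨ cong (_* (f B * g C)) (sgn-+ ∣ B ∣ ∣ C ∣) ⟨
    sgn (∣ B ∣ +ℕ ∣ C ∣) * (f B * g C)    ≡⟨ *-assoc (sgn (∣ B ∣ +ℕ ∣ C ∣)) (f B) (g C) ⟨
    sgn (∣ B ∣ +ℕ ∣ C ∣) * f B * g C      ∎
    where open ≡-Reasoning

module Weights (x y : ℚ) .{{_ : NonZero x}} .{{_ : NonZero y}} where

  weight : Graph n → Subset n → ℚ
  weight G X = (x ^ ∣ X ∣) * (y ^ components (induced G X))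

  Q-sum : (G : Graph n) → Q G x y ≡ Σₛ (λ X → when (X ⊆? V G) (weight G X))
  Q-sum {n} G = trans (subsetsWith-Σₛ (λ X → X ⊆ᵇ V G) (weight G))
                      (Σₛ-cong (λ X → cong (λ b → when b (weight G X)) (⊆ᵇ≡⊆? X (V G))))

  Q-delete : (H : Graph n) (B : Subset n) →
    Q (H -ᴳ B) x y ≡ Σₛ (λ Y → when (Y ⊆? V H) (when (Y ∩ B ≐ ⊥) (weight H Y)))
  Q-delete H B = trans (Q-sum (H -ᴳ B)) (Σₛ-cong λ Y → begin
    when (Y ⊆? (V H ─ B)) (weight (H -ᴳ B) Y)
      ≡⟨ cong (λ b → when b (weight (H -ᴳ B) Y)) (⊆?-─ Y (V H) B) ⟩
    when ((Y ⊆? V H) ∧ (Y ∩ B ≐ ⊥)) (weight (H -ᴳ B) Y)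
      ≡⟨ when-∧ (Y ⊆? V H) (Y ∩ B ≐ ⊥) _ ⟩
    when (Y ⊆? V H) (when (Y ∩ B ≐ ⊥) (weight (H -ᴳ B) Y))
      ≡⟨ cong (when (Y ⊆? V H)) (when-cong (Y ∩ B ≐ ⊥) (λ avoid →
           cong (λ k → (x ^ ∣ Y ∣) * (y ^ k)) (deleted-induced H B Y avoid))) ⟩
    when (Y ⊆? V H) (when (Y ∩ B ≐ ⊥) (weight H Y)) ∎)
    where open ≡-Reasoning

  traceSum : Graph n → Subset n → Subset n → ℚ
  traceSum H U A = Σₛ (λ Y → when (Y ⊆? V H) (when (Y ∩ U ≐ A) (weight H Y)))

  exact-trace : (H : Graph n) (U A : Subset n) →
    Σₛ (λ B → when (B ⊆? U) (when (U ─ A ⊆? B) (sgn ∣ B ∣ * Q (H -ᴳ B) x y)))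
      ≡ sgn ∣ U ─ A ∣ * traceSum H U (A ∩ U)
  exact-trace {n} H U A = begin
    Σₛ (λ B → when (B ⊆? U) (when (U ─ A ⊆? B) (sgn ∣ B ∣ * Q (H -ᴳ B) x y)))
      ≡⟨ Σₛ-cong (λ B → cong (λ q → when (B ⊆? U) (when (U ─ A ⊆? B) (sgn ∣ B ∣ * q))) (Q-delete H B)) ⟩
    Σₛ (λ B → when (B ⊆? U) (when (U ─ A ⊆? B) (sgn ∣ B ∣ * Σₛ (λ Y → inH Y (when (Y ∩ B ≐ ⊥) (weight H Y))))))
      ≡⟨ Σₛ-cong (λ B → distribute B) ⟩
    Σₛ (λ B → Σₛ (λ Y → inH Y (weight H Y * ieTerm U A Y B)))
      ≡⟨ Σ-swap (allSubsets n) (allSubsets n) (λ B Y → inH Y (weight H Y * ieTerm U A Y B)) ⟩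
    Σₛ (λ Y → Σₛ (λ B → inH Y (weight H Y * ieTerm U A Y B)))
      ≡⟨ Σₛ-cong (λ Y → trans (Σₛ-when (Y ⊆? V H) (λ B → weight H Y * ieTerm U A Y B))
                              (cong (inH Y) (Σ-*ˡ (allSubsets n) (weight H Y) (ieTerm U A Y)))) ⟩
    Σₛ (λ Y → inH Y (weight H Y * Σₛ (ieTerm U A Y)))
      ≡⟨ Σₛ-cong (λ Y → cong (λ q → inH Y (weight H Y * q)) (inclusion–exclusion U A Y)) ⟩
    Σₛ (λ Y → inH Y (weight H Y * when (Y ∩ U ≐ A ∩ U) (sgn ∣ U ─ A ∣)))
      ≡⟨ Σₛ-cong (λ Y → when-pull (Y ⊆? V H) (Y ∩ U ≐ A ∩ U) (weight H Y) (sgn ∣ U ─ A ∣)) ⟩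
    Σₛ (λ Y → sgn ∣ U ─ A ∣ * inH Y (when (Y ∩ U ≐ A ∩ U) (weight H Y)))
      ≡⟨ Σ-*ˡ (allSubsets n) (sgn ∣ U ─ A ∣) (λ Y → inH Y (when (Y ∩ U ≐ A ∩ U) (weight H Y))) ⟩
    sgn ∣ U ─ A ∣ * traceSum H U (A ∩ U) ∎
    where
    open ≡-Reasoning
    inH : Subset n → ℚ → ℚ
    inH Y = when (Y ⊆? V H)
    distribute : ∀ B →
      when (B ⊆? U) (when (U ─ A ⊆? B) (sgn ∣ B ∣ * Σₛ (λ Y → inH Y (when (Y ∩ B ≐ ⊥) (weight H Y)))))
        ≡ Σₛ (λ Y → inH Y (weight H Y * ieTerm U A Y B))
    distribute B = begin
      when (B ⊆? U) (when (U ─ A ⊆? B) (sgn ∣ B ∣ * Σₛ (λ Y → inH Y (when (Y ∩ B ≐ ⊥) (weight H Y)))))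
        ≡⟨ cong (λ q → when (B ⊆? U) (when (U ─ A ⊆? B) q))
                (sym (Σ-*ˡ (allSubsets n) (sgn ∣ B ∣) (λ Y → inH Y (when (Y ∩ B ≐ ⊥) (weight H Y))))) ⟩
      when (B ⊆? U) (when (U ─ A ⊆? B) (Σₛ (λ Y → sgn ∣ B ∣ * inH Y (when (Y ∩ B ≐ ⊥) (weight H Y)))))
        ≡⟨ trans (cong (when (B ⊆? U)) (sym (Σₛ-when (U ─ A ⊆? B) (λ Y → sgn ∣ B ∣ * inH Y (when (Y ∩ B ≐ ⊥) (weight H Y))))))
                 (sym (Σₛ-when (B ⊆? U) (λ Y → when (U ─ A ⊆? B) (sgn ∣ B ∣ * inH Y (when (Y ∩ B ≐ ⊥) (weight H Y)))))) ⟩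
      Σₛ (λ Y → when (B ⊆? U) (when (U ─ A ⊆? B) (sgn ∣ B ∣ * inH Y (when (Y ∩ B ≐ ⊥) (weight H Y)))))
        ≡⟨ Σₛ-cong (λ Y → when-shuffle (B ⊆? U) (U ─ A ⊆? B) (Y ⊆? V H) (Y ∩ B ≐ ⊥) (sgn ∣ B ∣) (weight H Y)) ⟩
      Σₛ (λ Y → inH Y (weight H Y * ieTerm U A Y B)) ∎
  alternating : (H : Graph n) (U A : Subset n) →
    Σ[ subsetsWith n (λ B → (B ⊆ᵇ U) ∧ ((U ─ A) ⊆ᵇ B)) ] (λ B → sgn ∣ B ∣ * Q (H -ᴳ B) x y)
      ≡ sgn ∣ U ─ A ∣ * traceSum H U (A ∩ U)
  alternating {n} H U A = begin
    Σ[ subsetsWith n (λ B → (B ⊆ᵇ U) ∧ ((U ─ A) ⊆ᵇ B)) ] (λ B → sgn ∣ B ∣ * Q (H -ᴳ B) x y)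
      ≡⟨ subsetsWith-Σₛ (λ B → (B ⊆ᵇ U) ∧ ((U ─ A) ⊆ᵇ B)) (λ B → sgn ∣ B ∣ * Q (H -ᴳ B) x y) ⟩
    Σₛ (λ B → when ((B ⊆ᵇ U) ∧ ((U ─ A) ⊆ᵇ B)) (sgn ∣ B ∣ * Q (H -ᴳ B) x y))
      ≡⟨ Σₛ-cong (λ B → trans (cong₂ (λ b c → when (b ∧ c) (sgn ∣ B ∣ * Q (H -ᴳ B) x y))
                                     (⊆ᵇ≡⊆? B U) (⊆ᵇ≡⊆? (U ─ A) B))
                              (when-∧ (B ⊆? U) (U ─ A ⊆? B) _)) ⟩
    Σₛ (λ B → when (B ⊆? U) (when (U ─ A ⊆? B) (sgn ∣ B ∣ * Q (H -ᴳ B) x y)))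
      ≡⟨ exact-trace H U A ⟩
    sgn ∣ U ─ A ∣ * traceSum H U (A ∩ U) ∎
    where open ≡-Reasoning

  glue : Subset n → ℚ
  glue S = if S ≐ ⊥ then 1ℚ else (1/ y) * ((1/ x) ^ ∣ S ∣)

  combine : ∀ m s a b k t c d → m +ℕ s ≡ a +ℕ b → k +ℕ t ≡ c +ℕ d →
    ((x ^ a) * (y ^ c)) * ((x ^ b) * (y ^ d)) ≡ ((x ^ m) * (y ^ k)) * ((x ^ s) * (y ^ t))
  combine m s a b k t c d sizes comps = begin
    ((x ^ a) * (y ^ c)) * ((x ^ b) * (y ^ d)) ≡⟨ *-interchange (x ^ a) (y ^ c) (x ^ b) (y ^ d) ⟩
    ((x ^ a) * (x ^ b)) * ((y ^ c) * (y ^ d)) ≡⟨ cong₂ _*_ (sym (^-+ x a b)) (sym (^-+ y c d)) ⟩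
    (x ^ (a +ℕ b)) * (y ^ (c +ℕ d))         ≡⟨ cong₂ (λ i j → (x ^ i) * (y ^ j)) (sym sizes) (sym comps) ⟩
    (x ^ (m +ℕ s)) * (y ^ (k +ℕ t))         ≡⟨ cong₂ _*_ (^-+ x m s) (^-+ y k t) ⟩
    ((x ^ m) * (x ^ s)) * ((y ^ k) * (y ^ t)) ≡⟨ *-interchange (x ^ m) (x ^ s) (y ^ k) (y ^ t) ⟩
    ((x ^ m) * (y ^ k)) * ((x ^ s) * (y ^ t)) ∎
    where open ≡-Reasoning

  -- The factor glue S undoes the extra vertices x^|S| and, if S ≠ ∅, the
  -- extra component y that S contributes when H and K are glued along it.
  glue-cancels : (S : Subset n) (W : ℚ) → glue S * (W * ((x ^ ∣ S ∣) * (y ^ bit (not (S ≐ ⊥))))) ≡ W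
  glue-cancels {n} S W = by-emptiness (S ≐ ⊥) refl
    where
    open ≡-Reasoning
    by-emptiness : ∀ e → S ≐ ⊥ ≡ e → glue S * (W * ((x ^ ∣ S ∣) * (y ^ bit (not (S ≐ ⊥))))) ≡ W
    by-emptiness true empty = begin
      glue S * (W * ((x ^ ∣ S ∣) * (y ^ bit (not (S ≐ ⊥)))))
        ≡⟨ cong₂ (λ e i → (if e then 1ℚ else (1/ y) * ((1/ x) ^ ∣ S ∣)) * (W * ((x ^ i) * (y ^ bit (not e)))))
                 empty (trans (cong ∣_∣ (≐-sound S ⊥ empty)) (∣⊥∣≡0 n)) ⟩
      1ℚ * (W * 1ℚ)  ≡⟨ trans (*-identityˡ (W * 1ℚ)) (*-identityʳ W) ⟩
      W              ∎
    by-emptiness false nonempty = begin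
      glue S * (W * ((x ^ ∣ S ∣) * (y ^ bit (not (S ≐ ⊥)))))
        ≡⟨ cong (λ e → (if e then 1ℚ else (1/ y) * ((1/ x) ^ ∣ S ∣)) * (W * ((x ^ ∣ S ∣) * (y ^ bit (not e)))))
                nonempty ⟩
      ((1/ y) * ((1/ x) ^ ∣ S ∣)) * (W * ((x ^ ∣ S ∣) * (y * 1ℚ)))
        ≡⟨ rearrange (1/ y) ((1/ x) ^ ∣ S ∣) W (x ^ ∣ S ∣) y ⟩
      W * (((1/ x) ^ ∣ S ∣ * x ^ ∣ S ∣) * (1/ y * y))
        ≡⟨ cong (W *_) (cong₂ _*_ (^-inverse x ∣ S ∣) (*-inverseˡ y)) ⟩
      W * 1ℚ         ≡⟨ *-identityʳ W ⟩
      W              ∎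
      where
      rearrange : ∀ i j w a b → (i * j) * (w * (a * (b * 1ℚ))) ≡ w * ((j * a) * (i * b))
      rearrange = solve 5 (λ i j w a b → (i :* j) :* (w :* (a :* (b :* con 1ℚ))) := w :* ((j :* a) :* (i :* b))) refl
        where open +-*-Solver

  module Glued {n} (G H K Kr : Graph n) (simple-H : SimpleGraph H) (simple-K : SimpleGraph K)
    (union : H ∪ᴳ K ≡ G) (meet : H ∩ᴳ K ≡ Kr) (complete : Complete Kr) where

    U : Subset n
    U = V Kr

    U-meet : V H ∩ V K ≡ U
    U-meet = proj₁ meet

    components-glued : ∀ X → components (induced H (X ∩ V H)) +ℕ components (induced K (X ∩ V K))
                             ≡ components (induced G X) +ℕ bit (not (X ∩ U ≐ ⊥))
    components-glued X = begin
      components (induced H (X ∩ V H)) +ℕ components (induced K (X ∩ V K))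
        ≡⟨ cong₂ _+ℕ_ (induced-restrict H X simple-H) (induced-restrict K X simple-K) ⟩
      components (induced H X) +ℕ components (induced K X)
        ≡⟨ gluing (induced G X) (induced H X) (induced K X)
                  (induced-simple H X simple-H) (induced-simple K X simple-K)
                  (induced-union G H K X union) (induced-clique H K Kr X meet complete) ⟩
      components (induced G X) +ℕ bit (not (V (induced H X) ∩ V (induced K X) ≐ ⊥))
        ≡⟨ cong (λ S → components (induced G X) +ℕ bit (not (S ≐ ⊥)))
                (trans (induced-meet H K X) (cong (X ∩_) U-meet)) ⟩
      components (induced G X) +ℕ bit (not (X ∩ U ≐ ⊥)) ∎
      where open ≡-Reasoning

    size-glued : ∀ X → X ⊆? V G ≡ true → ∣ X ∣ +ℕ ∣ X ∩ U ∣ ≡ ∣ X ∩ V H ∣ +ℕ ∣ X ∩ V K ∣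
    size-glued X X⊆G = begin
      ∣ X ∣ +ℕ ∣ X ∩ U ∣
        ≡⟨ cong₂ (λ P R → ∣ P ∣ +ℕ ∣ R ∣) (sym parts-cover) (sym parts-meet) ⟩
      ∣ (X ∩ V H) ∪ (X ∩ V K) ∣ +ℕ ∣ (X ∩ V H) ∩ (X ∩ V K) ∣
        ≡⟨ ∣∪∣+∣∩∣ (X ∩ V H) (X ∩ V K) ⟩
      ∣ X ∩ V H ∣ +ℕ ∣ X ∩ V K ∣ ∎
      where
      open ≡-Reasoning
      parts-cover : (X ∩ V H) ∪ (X ∩ V K) ≡ X
      parts-cover = trans (sym (∩-distribˡ-∪ X (V H) (V K)))
                          (trans (cong (X ∩_) (proj₁ union)) (⊆?-∩ X (V G) X⊆G))
      parts-meet : (X ∩ V H) ∩ (X ∩ V K) ≡ X ∩ U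
      parts-meet = trans (prove 3 ((s ⊕ h) ⊕ (s ⊕ k)) (s ⊕ (h ⊕ k)) (X ∷ V H ∷ V K ∷ [])) (cong (X ∩_) U-meet)
        where
        open ∩-Solver
        s = var fzero
        h = var (fsuc fzero)
        k = var (fsuc (fsuc fzero))

    weight-glued : ∀ X → X ⊆? V G ≡ true →
      weight G X ≡ glue (X ∩ U) * (weight H (X ∩ V H) * weight K (X ∩ V K))
    weight-glued X X⊆G = begin
      weight G X
        ≡⟨ glue-cancels (X ∩ U) (weight G X) ⟨
      glue (X ∩ U) * (weight G X * ((x ^ ∣ X ∩ U ∣) * (y ^ bit (not (X ∩ U ≐ ⊥)))))
        ≡⟨ cong (glue (X ∩ U) *_)
                (combine (∣ X ∣) (∣ X ∩ U ∣) (∣ X ∩ V H ∣) (∣ X ∩ V K ∣)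
                         (components (induced G X)) (bit (not (X ∩ U ≐ ⊥)))
                         (components (induced H (X ∩ V H))) (components (induced K (X ∩ V K)))
                         (size-glued X X⊆G) (sym (components-glued X))) ⟨
      glue (X ∩ U) * (weight H (X ∩ V H) * weight K (X ∩ V K)) ∎
      where open ≡-Reasoning

    per-trace : ∀ A → Σₛ (λ X → when (X ∩ U ≐ A) (when (X ⊆? V G) (weight G X)))
                      ≡ glue A * (traceSum H U A * traceSum K U A)
    per-trace A = begin
      Σₛ (λ X → when (X ∩ U ≐ A) (when (X ⊆? V G) (weight G X)))
        ≡⟨ Σₛ-cong (λ X → trans (when-comm (X ∩ U ≐ A) (X ⊆? V G) (weight G X)) (split X)) ⟩
      Σₛ (λ X → glue A * when (X ⊆? V H ∪ V K) (Φ (X ∩ V H) (X ∩ V K)))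
        ≡⟨ Σ-*ˡ (allSubsets n) (glue A) (λ X → when (X ⊆? V H ∪ V K) (Φ (X ∩ V H) (X ∩ V K))) ⟩
      glue A * Σₛ (λ X → when (X ⊆? V H ∪ V K) (Φ (X ∩ V H) (X ∩ V K)))
        ≡⟨ cong (glue A *_) (Σₛ-union (V H) (V K) Φ) ⟨
      glue A * Σₛ (λ Y → Σₛ (λ Z → onAgreeingPairs (V H) (V K) Y Z (Φ Y Z)))
        ≡⟨ cong (glue A *_) (Σₛ-cong (λ Y → Σₛ-cong (λ Z → pair Y Z))) ⟩
      glue A * Σₛ (λ Y → Σₛ (λ Z → tH Y * tK Z))
        ≡⟨ cong (glue A *_) (Σ-product (allSubsets n) (allSubsets n) tH tK) ⟨
      glue A * (traceSum H U A * traceSum K U A) ∎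
      where
      open ≡-Reasoning
      tH tK : Subset n → ℚ
      tH Y = when (Y ⊆? V H) (when (Y ∩ U ≐ A) (weight H Y))
      tK Z = when (Z ⊆? V K) (when (Z ∩ U ≐ A) (weight K Z))
      Φ : Subset n → Subset n → ℚ
      Φ Y Z = when (Y ∩ U ≐ A) (weight H Y * weight K Z)
      split : ∀ X → when (X ⊆? V G) (when (X ∩ U ≐ A) (weight G X))
                    ≡ glue A * when (X ⊆? V H ∪ V K) (Φ (X ∩ V H) (X ∩ V K))
      split X = begin
        when (X ⊆? V G) (when (X ∩ U ≐ A) (weight G X))
          ≡⟨ when-cong (X ⊆? V G) (λ X⊆G → when-cong (X ∩ U ≐ A) (λ trace →
               trans (weight-glued X X⊆G) (cong (λ S → glue S * _) (≐-sound (X ∩ U) A trace)))) ⟩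
        when (X ⊆? V G) (when (X ∩ U ≐ A) (glue A * (weight H (X ∩ V H) * weight K (X ∩ V K))))
          ≡⟨ cong (when (X ⊆? V G)) (when-*ˡ (X ∩ U ≐ A) (glue A) _) ⟩
        when (X ⊆? V G) (glue A * when (X ∩ U ≐ A) (weight H (X ∩ V H) * weight K (X ∩ V K)))
          ≡⟨ when-*ˡ (X ⊆? V G) (glue A) _ ⟩
        glue A * when (X ⊆? V G) (when (X ∩ U ≐ A) (weight H (X ∩ V H) * weight K (X ∩ V K)))
          ≡⟨ cong₂ (λ W S → glue A * when (X ⊆? W) (when (S ≐ A) (weight H (X ∩ V H) * weight K (X ∩ V K))))
                   (sym (proj₁ union)) (sym trace-of-part) ⟩
        glue A * when (X ⊆? V H ∪ V K) (Φ (X ∩ V H) (X ∩ V K)) ∎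
        where
        trace-of-part : (X ∩ V H) ∩ U ≡ X ∩ U
        trace-of-part = subst (λ W → (X ∩ V H) ∩ W ≡ X ∩ W) U-meet
                          (prove 3 ((s ⊕ h) ⊕ (h ⊕ k)) (s ⊕ (h ⊕ k)) (X ∷ V H ∷ V K ∷ []))
          where
          open ∩-Solver
          s = var fzero
          h = var (fsuc fzero)
          k = var (fsuc (fsuc fzero))
      pair : ∀ Y Z → onAgreeingPairs (V H) (V K) Y Z (Φ Y Z) ≡ tH Y * tK Z
      pair Y Z = sym (begin
        tH Y * tK Z
          ≡⟨ when-* (Y ⊆? V H) (Z ⊆? V K) _ _ ⟩
        when (Y ⊆? V H) (when (Z ⊆? V K) (when (Y ∩ U ≐ A) (weight H Y) * when (Z ∩ U ≐ A) (weight K Z)))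
          ≡⟨ cong (λ q → when (Y ⊆? V H) (when (Z ⊆? V K) q)) (when-* (Y ∩ U ≐ A) (Z ∩ U ≐ A) _ _) ⟩
        when (Y ⊆? V H) (when (Z ⊆? V K) (when (Y ∩ U ≐ A) (when (Z ∩ U ≐ A) (weight H Y * weight K Z))))
          ≡⟨ cong (λ q → when (Y ⊆? V H) (when (Z ⊆? V K) q)) (≐-guards (Y ∩ U) (Z ∩ U) A _) ⟩
        when (Y ⊆? V H) (when (Z ⊆? V K) (when (Y ∩ U ≐ Z ∩ U) (Φ Y Z)))
          ≡⟨ cong (λ W → when (Y ⊆? V H) (when (Z ⊆? V K) (when (Y ∩ W ≐ Z ∩ W) (Φ Y Z)))) U-meet ⟨
        onAgreeingPairs (V H) (V K) Y Z (Φ Y Z) ∎)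

    ∅ : Subset n
    ∅ = ⊥

    Θ : Subset n → ℚ
    Θ A = traceSum H U A * traceSum K U A

    Q-by-trace : Q G x y ≡ Θ ∅ + Σₛ (λ A → when (not (A ≐ ⊥)) (when (A ⊆? U) (glue A * Θ A)))
    Q-by-trace = begin
      Q G x y
        ≡⟨ Q-sum G ⟩
      Σₛ (λ X → when (X ⊆? V G) (weight G X))
        ≡⟨ Σₛ-by-trace U (λ X → when (X ⊆? V G) (weight G X)) ⟩
      Σₛ (λ A → when (A ⊆? U) (Σₛ (λ X → when (X ∩ U ≐ A) (when (X ⊆? V G) (weight G X)))))
        ≡⟨ Σₛ-cong (λ A → cong (when (A ⊆? U)) (per-trace A)) ⟩
      Σₛ (λ A → when (A ⊆? U) (glue A * Θ A))
        ≡⟨ Σₛ-split-⊥ (λ A → when (A ⊆? U) (glue A * Θ A)) ⟩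
      when (∅ ⊆? U) (glue ∅ * Θ ∅) + Σₛ (λ A → when (not (A ≐ ⊥)) (when (A ⊆? U) (glue A * Θ A)))
        ≡⟨ cong (_+ Σₛ (λ A → when (not (A ≐ ⊥)) (when (A ⊆? U) (glue A * Θ A)))) empty-trace ⟩
      Θ ∅ + Σₛ (λ A → when (not (A ≐ ⊥)) (when (A ⊆? U) (glue A * Θ A))) ∎
      where
      open ≡-Reasoning
      empty-trace : when (∅ ⊆? U) (glue ∅ * Θ ∅) ≡ Θ ∅
      empty-trace = trans (cong (λ b → when b (glue ∅ * Θ ∅)) (⊥-⊆? U))
        (trans (cong (λ e → (if e then 1ℚ else (1/ y) * ((1/ x) ^ ∣ ∅ ∣)) * Θ ∅) (≐-refl ∅)) (*-identityˡ (Θ ∅)))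

    signedPairs : Subset n → ℚ
    signedPairs A =
      Σ[ subsetsWith n (λ B → (B ⊆ᵇ U) ∧ ((U ─ A) ⊆ᵇ B)) ] (λ B →
        Σ[ subsetsWith n (λ C → (C ⊆ᵇ U) ∧ ((U ─ A) ⊆ᵇ C)) ] (λ C →
          sgn (∣ B ∣ +ℕ ∣ C ∣) * Q (H -ᴳ B) x y * Q (K -ᴳ C) x y))

    -- By inclusion–exclusion on both sides, it is the product of the traceSums.
    signed-pairs : ∀ A → A ⊆? U ≡ true → signedPairs A ≡ Θ A
    signed-pairs A A⊆U = begin
      signedPairs A
        ≡⟨ signed-product Bs Bs (λ B → Q (H -ᴳ B) x y) (λ C → Q (K -ᴳ C) x y) ⟩
      Σ[ Bs ] (λ B → sgn ∣ B ∣ * Q (H -ᴳ B) x y) * Σ[ Bs ] (λ C → sgn ∣ C ∣ * Q (K -ᴳ C) x y)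
        ≡⟨ cong₂ _*_ (alternating H U A) (alternating K U A) ⟩
      (sgn ∣ U ─ A ∣ * traceSum H U (A ∩ U)) * (sgn ∣ U ─ A ∣ * traceSum K U (A ∩ U))
        ≡⟨ *-interchange (sgn ∣ U ─ A ∣) _ (sgn ∣ U ─ A ∣) _ ⟩
      (sgn ∣ U ─ A ∣ * sgn ∣ U ─ A ∣) * Θ (A ∩ U)
        ≡⟨ cong₂ _*_ (sgn² ∣ U ─ A ∣) (cong Θ (⊆?-∩ A U A⊆U)) ⟩
      1ℚ * Θ A
        ≡⟨ *-identityˡ (Θ A) ⟩
      Θ A ∎
      where
      open ≡-Reasoning
      Bs = subsetsWith n (λ B → (B ⊆ᵇ U) ∧ ((U ─ A) ⊆ᵇ B))

    statement-by-trace :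
      Q (H -ᴳ U) x y * Q (K -ᴳ U) x y
        + (1/ y) * Σ[ subsetsWith n (λ A → nonemptyᵇ A ∧ (A ⊆ᵇ U)) ] (λ A → ((1/ x) ^ ∣ A ∣) * signedPairs A)
      ≡ Θ ∅ + Σₛ (λ A → when (not (A ≐ ⊥)) (when (A ⊆? U) (glue A * Θ A)))
    statement-by-trace = cong₂ _+_ (cong₂ _*_ (Q-delete H U) (Q-delete K U)) (begin
      (1/ y) * Σ[ subsetsWith n (λ A → nonemptyᵇ A ∧ (A ⊆ᵇ U)) ] (λ A → ((1/ x) ^ ∣ A ∣) * signedPairs A)
        ≡⟨ cong ((1/ y) *_) (subsetsWith-Σₛ (λ A → nonemptyᵇ A ∧ (A ⊆ᵇ U)) (λ A → ((1/ x) ^ ∣ A ∣) * signedPairs A)) ⟩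
      (1/ y) * Σₛ (λ A → when (nonemptyᵇ A ∧ (A ⊆ᵇ U)) (((1/ x) ^ ∣ A ∣) * signedPairs A))
        ≡⟨ cong ((1/ y) *_) (Σₛ-cong guards) ⟩
      (1/ y) * Σₛ (λ A → when (not (A ≐ ⊥)) (when (A ⊆? U) (((1/ x) ^ ∣ A ∣) * Θ A)))
        ≡⟨ Σ-*ˡ (allSubsets n) (1/ y) (λ A → when (not (A ≐ ⊥)) (when (A ⊆? U) (((1/ x) ^ ∣ A ∣) * Θ A))) ⟨
      Σₛ (λ A → (1/ y) * when (not (A ≐ ⊥)) (when (A ⊆? U) (((1/ x) ^ ∣ A ∣) * Θ A)))
        ≡⟨ Σₛ-cong glue-in ⟩
      Σₛ (λ A → when (not (A ≐ ⊥)) (when (A ⊆? U) (glue A * Θ A))) ∎)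
      where
      open ≡-Reasoning
      guards : ∀ A → when (nonemptyᵇ A ∧ (A ⊆ᵇ U)) (((1/ x) ^ ∣ A ∣) * signedPairs A)
                     ≡ when (not (A ≐ ⊥)) (when (A ⊆? U) (((1/ x) ^ ∣ A ∣) * Θ A))
      guards A = begin
        when (nonemptyᵇ A ∧ (A ⊆ᵇ U)) (((1/ x) ^ ∣ A ∣) * signedPairs A)
          ≡⟨ cong₂ (λ a b → when (a ∧ b) (((1/ x) ^ ∣ A ∣) * signedPairs A)) (nonemptyᵇ≡ A) (⊆ᵇ≡⊆? A U) ⟩
        when (not (A ≐ ⊥) ∧ (A ⊆? U)) (((1/ x) ^ ∣ A ∣) * signedPairs A)
          ≡⟨ when-∧ (not (A ≐ ⊥)) (A ⊆? U) _ ⟩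
        when (not (A ≐ ⊥)) (when (A ⊆? U) (((1/ x) ^ ∣ A ∣) * signedPairs A))
          ≡⟨ cong (when (not (A ≐ ⊥))) (when-cong (A ⊆? U) (λ A⊆U → cong (((1/ x) ^ ∣ A ∣) *_) (signed-pairs A A⊆U))) ⟩
        when (not (A ≐ ⊥)) (when (A ⊆? U) (((1/ x) ^ ∣ A ∣) * Θ A)) ∎
      glue-in : ∀ A → (1/ y) * when (not (A ≐ ⊥)) (when (A ⊆? U) (((1/ x) ^ ∣ A ∣) * Θ A))
                      ≡ when (not (A ≐ ⊥)) (when (A ⊆? U) (glue A * Θ A))
      glue-in A = begin
        (1/ y) * when (not (A ≐ ⊥)) (when (A ⊆? U) (((1/ x) ^ ∣ A ∣) * Θ A))
          ≡⟨ trans (sym (when-*ˡ (not (A ≐ ⊥)) (1/ y) _)) (cong (when (not (A ≐ ⊥))) (sym (when-*ˡ (A ⊆? U) (1/ y) _))) ⟩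
        when (not (A ≐ ⊥)) (when (A ⊆? U) ((1/ y) * (((1/ x) ^ ∣ A ∣) * Θ A)))
          ≡⟨ cong (λ q → when (not (A ≐ ⊥)) (when (A ⊆? U) q)) (sym (*-assoc (1/ y) ((1/ x) ^ ∣ A ∣) (Θ A))) ⟩
        when (not (A ≐ ⊥)) (when (A ⊆? U) (((1/ y) * ((1/ x) ^ ∣ A ∣)) * Θ A))
          ≡⟨ when-cong (not (A ≐ ⊥)) (λ nonempty → cong (λ g → when (A ⊆? U) (g * Θ A))
               (cong (λ e → if e then 1ℚ else (1/ y) * ((1/ x) ^ ∣ A ∣)) (not-true nonempty))) ⟨
        when (not (A ≐ ⊥)) (when (A ⊆? U) (glue A * Θ A)) ∎

theorem6p2 : (n : ℕ) (G H K Kr : Graph n) →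
    SimpleGraph G → Connected G →
    H IsSubgraphOf G → K IsSubgraphOf G →
    H ∪ᴳ K ≡ G → H ∩ᴳ K ≡ Kr → Complete Kr →
    ¬ (H ≅ᴳ Kr) → ¬ (K ≅ᴳ Kr) →
    (x y : ℚ) .{{_ : NonZero x}} .{{_ : NonZero y}} →
    Q G x y ≡
      Q (H -ᴳ V Kr) x y * Q (K -ᴳ V Kr) x y
      + (1/ y) * Σ[ subsetsWith n (λ A → nonemptyᵇ A ∧ (A ⊆ᵇ V Kr)) ] (λ A →
          ((1/ x) ^ ∣ A ∣) *
          Σ[ subsetsWith n (λ B → (B ⊆ᵇ V Kr) ∧ ((V Kr ─ A) ⊆ᵇ B)) ] (λ B →
            Σ[ subsetsWith n (λ C → (C ⊆ᵇ V Kr) ∧ ((V Kr ─ A) ⊆ᵇ C)) ] (λ C →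
              sgn (∣ B ∣ +ℕ ∣ C ∣) * Q (H -ᴳ B) x y * Q (K -ᴳ C) x y)))
theorem6p2 n G H K Kr _ _ (simple-H , _) (simple-K , _) union meet complete _ _ x y =
  trans Q-by-trace (sym statement-by-trace)
  where
  open Weights x y
  open Glued G H K Kr simple-H simple-K union meet complete
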